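{- For set supercompositions $I$ and $J$, $$M_IM_J=\sum_{K\in\operatorname{QSh}(I,J)}\operatorname{sgn}(K)\,M_K.$$ Consequently $\operatorname{sNCQSym}$ is a subalgebra of $\mathbb{Q}^\theta\langle\langle x\rangle\rangle$.
   Context: $\mathbb{Q}^\theta\langle\langle x\rangle\rangle$: bounded-degree formal power series over $\mathbb{Q}$ in noncommuting $x_1,x_2,\ldots$ and $\theta_1,\theta_2,\ldots$ with $x_i\theta_j=\theta_jx_i$, $\theta_i\theta_j=-\theta_j\theta_i$; monomials in normal form $\theta_{i_1}\cdots\theta_{i_m}x_{j_1}\cdots x_{j_n}$, $i_1<\cdots<i_m$. For such $u$, $\operatorname{ind}(u)=\{i_1,\ldots,i_m,j_1,\ldots,j_n\}$, and $\operatorname{std}(u)$ relabels indices by the order-preserving bijection $\operatorname{ind}(u)\to[k]$. $\operatorname{sNCQSym}$ is the set of series in which monic monomials with the same standardization have equal coefficients. A set supercomposition of bidegree $(n,m)$ is a sequence $I=(I_1,\ldots,I_h)$ of nonempty subsets of $\{0,\ldots,n\}$ with $I_i\cap I_j\subseteq\{0\}$ ($i\ne j$), $\bigcup(I_i\setminus\{0\})=[n]$, and $m$ fermionic blocks (those containing $0$). For a monic monomial $u$ with $\operatorname{std}(u)=\theta_{i_1}\cdots\theta_{i_m}x_{j_1}\cdots x_{j_n}$, $I(u)=(I_1,\ldots,I_k)$, $k=|\operatorname{ind}(u)|$, $I_r=\{t: j_t=r\}\cup(\{0\}$ if $r\in\{i_1,\ldots,i_m\})$; $M_I=\sum_{I(u)=I}u$.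 Quasi-shuffles: let $I$ have bidegree $(n,m)$ and $J=(J_1,\ldots,J_k)$; $J[n]$ adds $n$ to every positive element of each block. An $(I,J)$-shuffle is an arrangement $L$ of the blocks of $I$ and of $J[n]$ preserving the relative order within each; $\varepsilon(L)$ is the number of pairs of fermionic blocks $I_i$, $J_j[n]$ with $J_j[n]$ appearing before $I_i$ in $L$. An $(I,J)$-quasi-shuffle is a set supercomposition obtained from an $(I,J)$-shuffle $L$ by a (possibly empty) sequence of mergers of consecutive blocks $L_i,L_{i+1}$ into $L_i\cup L_{i+1}$, where $L_i$ is a block of $I$, $L_{i+1}$ is a block of $J[n]$, and they are not both fermionic. $\operatorname{QSh}(I,J)$ is the set of these and $\operatorname{sgn}(K)=(-1)^{\varepsilon(L)}$ for the unique shuffle $L$ producing $K$. -}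

module Defs where

open import Data.Bool using (Bool; true; false; if_then_else_; _∨_; _∧_; not)
open import Data.Nat using (ℕ; zero; suc; _+_; _∸_; _<ᵇ_; _≡ᵇ_; _<_)
import Data.Nat as ℕ
open import Data.List using (List; []; _∷_; _++_; map; concat; concatMap; length; foldr; filter; applyUpTo)
open import Data.Bool.ListAction using (any)
open import Data.List.Properties using (≡-dec)
open import Data.List.Relation.Unary.All using (All)
open import Data.List.Relation.Unary.Linked using (Linked)
open import Data.List.Relation.Binary.Permutation.Propositional using (_↭_)
open import Data.Product using (_×_; _,_; proj₁; proj₂; ∃)
open import Data.Rational using (ℚ; 0ℚ; 1ℚ; -_) renaming (_+_ to _+ℚ_; _*_ to _*ℚ_)
open import Relation.Binary.PropositionalEquality using (_≡_; _≢_)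
open import Relation.Nullary using (does)

-- Monic monomials of Q^θ<<x>> in normal form
--   θ_{i1} ⋯ θ_{im} x_{j1} ⋯ x_{jn},  i1 < ⋯ < im.  The strictly increasing θ-index list
-- is stored canonically (without proofs) by its "gaps":
--   [i1, i2 - i1 - 1, i3 - i2 - 1, …]
-- so that Mono is in bijection with normal-form monic monomials.

Mono : Set
Mono = List ℕ × List ℕ     -- (θ-gaps , x-word)

decodeFrom : ℕ → List ℕ → List ℕ
decodeFrom acc []       = []
decodeFrom acc (g ∷ gs) = (acc + g) ∷ decodeFrom (suc (acc + g)) gs

decode : List ℕ → List ℕ
decode = decodeFrom 0

encodeFrom : ℕ → List ℕ → List ℕ
encodeFrom acc []       = []
encodeFrom acc (a ∷ as) = (a ∸ acc) ∷ encodeFrom (suc a) as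

encode : List ℕ → List ℕ
encode = encodeFrom 0

thetaIdx : Mono → List ℕ
thetaIdx u = decode (proj₁ u)

xWord : Mono → List ℕ
xWord u = proj₂ u

mkMono : List ℕ → List ℕ → Mono
mkMono th xs = encode th , xs

degree : Mono → ℕ
degree u = length (thetaIdx u) + length (xWord u)

Series : Set
Series = Mono → ℚ

BoundedDegree : Series → Set
BoundedDegree f = ∃ λ d → ∀ u → d < degree u → f u ≡ 0ℚ

sgnℚ : ℕ → ℚ
sgnℚ zero          = 1ℚ
sgnℚ (suc zero)    = - 1ℚ
sgnℚ (suc (suc c)) = sgnℚ c

sumℚ : List ℚ → ℚ
sumℚ = foldr _+ℚ_ 0ℚ

-- splits of an increasing θ-index list T into complementary subsequences
-- (A , B) together with the number of pairs (α ∈ A, β ∈ B, β < α),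
-- so that θ_A θ_B = (-1)^c θ_T.
splitsθ : List ℕ → List (List ℕ × List ℕ × ℕ)
splitsθ []       = ([] , [] , 0) ∷ []
splitsθ (t ∷ ts) =
  concatMap (λ { (A , B , c) → (t ∷ A , B , c) ∷ (A , t ∷ B , c + length A) ∷ [] })
            (splitsθ ts)

splitsX : List ℕ → List (List ℕ × List ℕ)
splitsX []       = ([] , []) ∷ []
splitsX (x ∷ xs) = ([] , x ∷ xs) ∷ map (λ { (a , b) → (x ∷ a , b) }) (splitsX xs)

-- Product in Q^θ<<x>>: (θ_A x_a)(θ_B x_b) = θ_A θ_B x_a x_b = (-1)^c θ_{A∪B} x_a x_b.
infixl 7 _·_
_·_ : Series → Series → Series
(f · g) w =
  sumℚ (concatMap
    (λ { (A , B , c) →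
      map (λ { (a , b) → sgnℚ c *ℚ (f (mkMono A a) *ℚ g (mkMono B b)) })
          (splitsX (xWord w)) })
    (splitsθ (thetaIdx w)))

_⊕_ : Series → Series → Series
(f ⊕ g) w = f w +ℚ g w

_⊙_ : ℚ → Series → Series
(q ⊙ f) w = q *ℚ f w

oneS : Series
oneS ([] , []) = 1ℚ
oneS _         = 0ℚ

insertU : ℕ → List ℕ → List ℕ
insertU v []       = v ∷ []
insertU v (a ∷ as) =
  if v <ᵇ a then v ∷ a ∷ as
  else if v ≡ᵇ a then a ∷ as
  else a ∷ insertU v as

ind : Mono → List ℕ
ind u = foldr insertU [] (thetaIdx u ++ xWord u)

-- 1-based rank of v in a list
rank : ℕ → List ℕ → ℕ
rank v []       = 0
rank v (a ∷ as) = if v ≡ᵇ a then 1 else suc (rank v as)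

std : Mono → Mono
std u = mkMono (map (λ v → rank v (ind u)) (thetaIdx u))
               (map (λ v → rank v (ind u)) (xWord u))

InSNCQSym : Series → Set
InSNCQSym f = BoundedDegree f × (∀ u v → std u ≡ std v → f u ≡ f v)

-- Set supercompositions.  A block (a nonempty subset of {0,…,n}) is
-- stored as its strictly increasing list of elements; a block is
-- fermionic iff it contains 0.

Block : Set
Block = List ℕ

SSC : Set
SSC = List Block

isZero : ℕ → Bool
isZero zero    = true
isZero (suc _) = false

fermionic : Block → Bool
fermionic b = any isZero b

positives : Block → List ℕ
positives b = filter (λ x → 0 <? x) b
  where open Data.Nat using (_<?_)

bidegN : SSC → ℕ
bidegN I = length (concatMap positives I)

IsSSC : SSC → Set
IsSSC I = All (λ b → b ≢ []) I
        × All (Linked _<_) I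
        × (concatMap positives I ↭ applyUpTo suc (bidegN I))

positionsFrom : ℕ → ℕ → List ℕ → List ℕ
positionsFrom t v []       = []
positionsFrom t v (x ∷ xs) =
  if v ≡ᵇ x then t ∷ positionsFrom (suc t) v xs else positionsFrom (suc t) v xs

memb : ℕ → List ℕ → Bool
memb v xs = any (λ a → v ≡ᵇ a) xs

sscOf : Mono → SSC
sscOf u = map block (applyUpTo suc k)
  where
  s  = std u
  k  = length (ind u)
  block : ℕ → Block
  block r = (if memb r (thetaIdx s) then 0 ∷ [] else [])
            ++ positionsFrom 1 r (xWord s)

_≟SSC_ : (I J : SSC) → Relation.Nullary.Dec (I ≡ J)
_≟SSC_ = ≡-dec (≡-dec Data.Nat._≟_)

M : SSC → Series
M I u = if does (sscOf u ≟SSC I) then 1ℚ else 0ℚ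

shift : ℕ → SSC → SSC
shift n J = map (map (λ x → if isZero x then 0 else x + n)) J

countFerm : SSC → ℕ
countFerm I = length (filter (λ b → Data.Bool._≟_ (fermionic b) true) I)

-- tagged blocks: true = block of I, false = block of J[n]
TBlock : Set
TBlock = Bool × Block

shuffles : SSC → SSC → List (List TBlock × ℕ)
shuffles []       ys       = (map (λ y → false , y) ys , 0) ∷ []
shuffles (x ∷ xs) []       = (map (λ z → true , z) (x ∷ xs) , 0) ∷ []
shuffles (x ∷ xs) (y ∷ ys) =
  map (λ { (L , e) → (true , x) ∷ L , e }) (shuffles xs (y ∷ ys))
  ++ map (λ { (L , e) → (false , y) ∷ L
                      , e + (if fermionic y then countFerm (x ∷ xs) else 0) })
         (shuffles (x ∷ xs) ys)

-- union of an I-block and a J[n]-block (all positives of the first are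
-- smaller than those of the second), as a sorted list
unionB : Block → Block → Block
unionB b c = (if fermionic b ∨ fermionic c then 0 ∷ [] else [])
             ++ positives b ++ positives c

merges : List TBlock → List SSC
merges []                    = [] ∷ []
merges ((_ , b) ∷ [])        = (b ∷ []) ∷ []
merges ((s , b) ∷ (t , c) ∷ rest) =
  map (b ∷_) (merges ((t , c) ∷ rest))
  ++ (if s ∧ not t ∧ not (fermionic b ∧ fermionic c)
        then map (unionB b c ∷_) (merges rest)
        else [])

-- QSh(I,J) with signs sgn(K) = (-1)^{ε(L)}: one entry for each
-- (I,J)-shuffle L and each admissible sequence of mergers applied to L.
-- (No deduplication: e.g. for I = J = ({0}) the two shuffles give the
-- same list of sets ({0},{0}) with opposite signs, and both terms must
-- be kept for the identity to hold, since θ_i θ_j + θ_j θ_i = 0.)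
qsh : SSC → SSC → List (SSC × ℕ)
qsh I J =
  concatMap (λ { (L , e) → map (λ K → K , e) (merges L) })
            (shuffles I (shift (bidegN I) J))

qshSum : SSC → SSC → Series
qshSum I J w = sumℚ (map (λ { (K , e) → sgnℚ e *ℚ M K w }) (qsh I J))

-- The coefficient of a monic monomial w in M_I M_J is a signed count of the factorizations
-- w = ± u v with I(u) = I and I(v) = J.  Such a factorization is chosen letter by letter: each
-- letter r of w sends its x-positions among the first n to u and the others to v, where (n, m) is
-- the bidegree of I, and sends θ_r, if present, to u or to v.  So the block of r in I(w) is a
-- block of I, a block of J[n], or the union of one of each, never of two fermionic ones since
-- θ_r θ_r = 0.  Expanding the quasi-shuffle sum along the first block of I(w) gives the same
-- three-way recursion; sending θ_r to v moves it across the θ's of the later letters of u, which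
-- is the sign of placing a fermionic block of J[n] before the fermionic blocks of I still to come.
-- Closure of sNCQSym under the product needs only that std is invariant under increasing
-- relabellings of the letters, and hence so is every term of (f · g)(w).

module Submission where

open import Defs

open import Data.Bool using (Bool; true; false; if_then_else_; _∨_; _∧_; not; T; T?)
open import Data.Bool.Properties using (∧-assoc) renaming (_≟_ to _≟𝔹_)
open import Data.Empty using (⊥-elim)
open import Data.List using (List; []; _∷_; _++_; map; foldr; length; concat; concatMap; filterᵇ; applyUpTo; take; drop)
open import Data.List.Membership.Propositional using (_∈_; _∉_; find)
open import Data.List.Membership.Propositional.Properties
  using (∈-++⁺ˡ; ∈-++⁺ʳ; ∈-++⁻; ∈-map⁺; ∈-map⁻; ∈-applyUpTo⁻; ∈-concatMap⁻; ∈-filter⁺; ∈-filter⁻)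
open import Data.List.Properties
  using ( map-++; map-∘; map-cong; map-cong-local; length-map; length-++; length-take; map-injective
        ; take++drop≡id; ++-identityʳ; concatMap-map; concatMap-cong; map-concatMap; ≡-dec; filter-all)
open import Data.List.Relation.Binary.Permutation.Propositional.Properties using (∈-resp-↭)
open import Data.List.Relation.Binary.Subset.Propositional using (_⊆_)
open import Data.List.Relation.Binary.Subset.Propositional.Properties using (xs⊆xs++ys; xs⊆ys++xs; ∷⁺ʳ; ++⁺; filter-⊆)
open import Data.List.Relation.Unary.All using (All; []; _∷_; tabulate)
import Data.List.Relation.Unary.All as All
open import Data.List.Relation.Unary.All.Properties using () renaming (++⁺ to All-++⁺; map⁺ to All-map⁺)
open import Data.List.Relation.Unary.Any using (here; there)
import Data.List.Relation.Unary.Any as Any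
open import Data.List.Relation.Unary.Linked using (Linked; []; [-]; _∷_)
import Data.List.Relation.Unary.Linked as Linked
open import Data.List.Relation.Unary.Linked.Properties using () renaming (filter⁺ to Linked-filter⁺)
open import Data.Nat using (ℕ; zero; suc; pred; _+_; _⊔_; _<ᵇ_; _≡ᵇ_; _<_; _≤_; _<?_; z≤n; s≤s)
open import Data.Nat.ListAction using (sum)
open import Data.Nat.Properties
  using ( _≟_; <ᵇ-reflects-<; <-irrefl; <-asym; <-trans; <-cmp; ≤-refl; ≤-trans; ≤-<-trans; <⇒≤; <⇒≱; ≤∧≢⇒<; ≮⇒≥
        ; ≤-pred; ≤-reflexive; m≤m+n; m≤n+m; m<m+n; m+[n∸m]≡n; +-suc; +-identityʳ; +-mono-≤; +-cancelʳ-≡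
        ; suc-injective; m≤m⊔n; m≤n⊔m; m⊓n≤m; +-commutativeSemigroup)
open import Algebra.Properties.CommutativeSemigroup +-commutativeSemigroup using () renaming (interchange to +-interchange)
open import Data.Product using (_×_; _,_; proj₁; proj₂; ∃-syntax)
open import Data.Rational using (ℚ; 0ℚ; 1ℚ; -_) renaming (_+_ to _+ℚ_; _*_ to _*ℚ_)
import Data.Rational.Properties as ℚ
open import Data.Rational.Solver using (module +-*-Solver)
open import Data.Sum using (_⊎_; [_,_]′)
open import Data.Unit using (tt)
open import Function using (_∘_; id)
open import Relation.Binary.Definitions using (tri<; tri≈; tri>)
open import Relation.Binary.PropositionalEquality
open import Relation.Nullary using (does; proof; yes; no)
open import Relation.Nullary.Decidable using (dec-true; dec-false)
open import Relation.Nullary.Reflects using (Reflects; ofʸ; ofⁿ; _⊎-reflects_)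

open +-*-Solver using (solve; _:+_; _:*_; :-_; _:=_; con)

map-cong-∈ : ∀ {A B : Set} {f g : A → B} xs → (∀ {x} → x ∈ xs → f x ≡ g x) → map f xs ≡ map g xs
map-cong-∈ xs f≗g = map-cong-local (tabulate f≗g)

sumℚ-++ : ∀ xs ys → sumℚ (xs ++ ys) ≡ sumℚ xs +ℚ sumℚ ys
sumℚ-++ []       ys = sym (ℚ.+-identityˡ _)
sumℚ-++ (x ∷ xs) ys = trans (cong (x +ℚ_) (sumℚ-++ xs ys)) (sym (ℚ.+-assoc x _ _))

sumℚ-concatMap : ∀ {A : Set} (f : A → List ℚ) xs → sumℚ (concatMap f xs) ≡ sumℚ (map (λ a → sumℚ (f a)) xs)
sumℚ-concatMap f []       = refl
sumℚ-concatMap f (a ∷ xs) = trans (sumℚ-++ (f a) (concatMap f xs)) (cong (sumℚ (f a) +ℚ_) (sumℚ-concatMap f xs))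

sumℚ-zero : ∀ {xs} → All (_≡ 0ℚ) xs → sumℚ xs ≡ 0ℚ
sumℚ-zero []          = refl
sumℚ-zero (refl ∷ zs) = trans (cong (0ℚ +ℚ_) (sumℚ-zero zs)) (ℚ.+-identityˡ 0ℚ)

sumℚ-map-zero : ∀ {A : Set} {f : A → ℚ} xs → (∀ {a} → a ∈ xs → f a ≡ 0ℚ) → sumℚ (map f xs) ≡ 0ℚ
sumℚ-map-zero xs f≡0 = trans (cong sumℚ (map-cong-∈ xs f≡0)) (sumℚ-zero (zeros xs))
  where
  zeros : ∀ {A : Set} (xs : List A) → All (_≡ 0ℚ) (map (λ _ → 0ℚ) xs)
  zeros []       = []
  zeros (_ ∷ xs) = refl ∷ zeros xs

sumℚ-map-*ˡ : ∀ {A : Set} c (f : A → ℚ) xs → sumℚ (map (λ a → c *ℚ f a) xs) ≡ c *ℚ sumℚ (map f xs)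
sumℚ-map-*ˡ c f []       = sym (ℚ.*-zeroʳ c)
sumℚ-map-*ˡ c f (a ∷ xs) = trans (cong (c *ℚ f a +ℚ_) (sumℚ-map-*ˡ c f xs)) (sym (ℚ.*-distribˡ-+ c (f a) _))

sumℚ-map-+ : ∀ {A : Set} (f g : A → ℚ) xs → sumℚ (map (λ a → f a +ℚ g a) xs) ≡ sumℚ (map f xs) +ℚ sumℚ (map g xs)
sumℚ-map-+ f g []       = refl
sumℚ-map-+ f g (a ∷ xs) = trans (cong (f a +ℚ g a +ℚ_) (sumℚ-map-+ f g xs))
  (solve 4 (λ x y z w → (x :+ y) :+ (z :+ w) := (x :+ z) :+ (y :+ w)) refl (f a) (g a) _ _)

sumℚ-map-++ : ∀ {A : Set} (f : A → ℚ) xs ys → sumℚ (map f (xs ++ ys)) ≡ sumℚ (map f xs) +ℚ sumℚ (map f ys)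
sumℚ-map-++ f xs ys = trans (cong sumℚ (map-++ f xs ys)) (sumℚ-++ (map f xs) (map f ys))

sumℚ-map-map : ∀ {A B : Set} (f : B → ℚ) (g : A → B) xs → sumℚ (map f (map g xs)) ≡ sumℚ (map (λ a → f (g a)) xs)
sumℚ-map-map f g xs = cong sumℚ (sym (map-∘ xs))

⟦_⟧ : Bool → ℚ
⟦ b ⟧ = if b then 1ℚ else 0ℚ

⟦∧⟧ : ∀ a b → ⟦ a ∧ b ⟧ ≡ ⟦ a ⟧ *ℚ ⟦ b ⟧
⟦∧⟧ true  b = sym (ℚ.*-identityˡ ⟦ b ⟧)
⟦∧⟧ false b = sym (ℚ.*-zeroˡ ⟦ b ⟧)

⟦∧⟧-rotate : ∀ a b c z → ⟦ c ⟧ *ℚ (⟦ a ∧ b ⟧ *ℚ z) ≡ ⟦ a ∧ (b ∧ c) ⟧ *ℚ z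
⟦∧⟧-rotate a b c z rewrite ⟦∧⟧ a b | ⟦∧⟧ a (b ∧ c) | ⟦∧⟧ b c =
  solve 4 (λ a b c z → c :* (a :* b :* z) := a :* (b :* c) :* z) refl ⟦ a ⟧ ⟦ b ⟧ ⟦ c ⟧ z

⟦∧⟧-swap : ∀ a b c z → ⟦ a ⟧ *ℚ (⟦ b ∧ c ⟧ *ℚ z) ≡ ⟦ b ∧ (a ∧ c) ⟧ *ℚ z
⟦∧⟧-swap a b c z rewrite ⟦∧⟧ b c | ⟦∧⟧ b (a ∧ c) | ⟦∧⟧ a c =
  solve 4 (λ a b c z → a :* (b :* c :* z) := b :* (a :* c) :* z) refl ⟦ a ⟧ ⟦ b ⟧ ⟦ c ⟧ z

sgnℚ-suc : ∀ c → sgnℚ (suc c) ≡ (- 1ℚ) *ℚ sgnℚ c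
sgnℚ-suc zero    = refl
sgnℚ-suc (suc c) = trans (solve 1 (λ x → x := (:- con 1ℚ) :* ((:- con 1ℚ) :* x)) refl (sgnℚ c))
                           (cong ((- 1ℚ) *ℚ_) (sym (sgnℚ-suc c)))

sgnℚ-+ : ∀ a b → sgnℚ (a + b) ≡ sgnℚ a *ℚ sgnℚ b
sgnℚ-+ zero          b = sym (ℚ.*-identityˡ _)
sgnℚ-+ (suc zero)    b = sgnℚ-suc b
sgnℚ-+ (suc (suc a)) b = sgnℚ-+ a b

length-concatMap : ∀ {A B : Set} (f : A → List B) xs → length (concatMap f xs) ≡ sum (map (λ a → length (f a)) xs)
length-concatMap f []       = refl
length-concatMap f (a ∷ xs) = trans (length-++ (f a)) (cong (length (f a) +_) (length-concatMap f xs))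

sum-map-+ : ∀ {A : Set} (f g : A → ℕ) xs → sum (map (λ a → f a + g a) xs) ≡ sum (map f xs) + sum (map g xs)
sum-map-+ f g []       = refl
sum-map-+ f g (a ∷ xs) = trans (cong (f a + g a +_) (sum-map-+ f g xs)) (+-interchange (f a) (g a) _ _)

sum-map-indicator : ∀ {A : Set} (p : A → Bool) xs → sum (map (λ a → if p a then 1 else 0) xs) ≡ length (filterᵇ p xs)
sum-map-indicator p []       = refl
sum-map-indicator p (a ∷ xs) with p a
... | true  = cong suc (sum-map-indicator p xs)
... | false = sum-map-indicator p xs

≡ᵇ-reflects : ∀ m n → Reflects (m ≡ n) (m ≡ᵇ n)
≡ᵇ-reflects m n = proof (m ≟ n)

≡ᵇ-refl : ∀ n → (n ≡ᵇ n) ≡ true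
≡ᵇ-refl n = dec-true (n ≟ n) refl

≢⇒≡ᵇ-false : ∀ {m n} → m ≢ n → (m ≡ᵇ n) ≡ false
≢⇒≡ᵇ-false {m} {n} = dec-false (m ≟ n)

≡ᵇ-sym : ∀ m n → (m ≡ᵇ n) ≡ (n ≡ᵇ m)
≡ᵇ-sym zero    zero    = refl
≡ᵇ-sym zero    (suc n) = refl
≡ᵇ-sym (suc m) zero    = refl
≡ᵇ-sym (suc m) (suc n) = ≡ᵇ-sym m n

reflects-T⇒ : ∀ {A : Set} {b} → Reflects A b → T b → A
reflects-T⇒ (ofʸ a) _ = a

reflects-⇒T : ∀ {A : Set} {b} → Reflects A b → A → T b
reflects-⇒T (ofʸ _)  _ = tt
reflects-⇒T (ofⁿ ¬a) a = ¬a a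

memb-reflects : ∀ v xs → Reflects (v ∈ xs) (memb v xs)
memb-reflects v []       = ofⁿ λ ()
memb-reflects v (x ∷ xs) with v ≡ᵇ x | ≡ᵇ-reflects v x | memb v xs | memb-reflects v xs
... | true  | ofʸ v≡x | _     | _          = ofʸ (here v≡x)
... | false | ofⁿ v≢x | true  | ofʸ v∈xs   = ofʸ (there v∈xs)
... | false | ofⁿ v≢x | false | ofⁿ v∉xs   = ofⁿ λ { (here v≡x) → v≢x v≡x ; (there v∈xs) → v∉xs v∈xs }

∉⇒memb : ∀ {v xs} → v ∉ xs → memb v xs ≡ false
∉⇒memb {v} {xs} v∉xs with memb v xs | memb-reflects v xs
... | true  | ofʸ v∈xs = ⊥-elim (v∉xs v∈xs)
... | false | _        = refl

Sorted : List ℕ → Set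
Sorted = Linked _<_

sorted-head : ∀ {x xs z} → Sorted (x ∷ xs) → z ∈ xs → x < z
sorted-head (x<y ∷ _) (here refl) = x<y
sorted-head (x<y ∷ s) (there z∈) = <-trans x<y (sorted-head s z∈)

sorted-head∉ : ∀ {x xs} → Sorted (x ∷ xs) → x ∉ xs
sorted-head∉ s x∈ = <-irrefl refl (sorted-head s x∈)

sorted-∷ : ∀ {x xs} → (∀ {z} → z ∈ xs → x < z) → Sorted xs → Sorted (x ∷ xs)
sorted-∷ {xs = []}    _    _ = [-]
sorted-∷ {xs = _ ∷ _} x<xs s = x<xs (here refl) ∷ s

sorted-⊆-antisym : ∀ {xs ys} → Sorted xs → Sorted ys → xs ⊆ ys → ys ⊆ xs → xs ≡ ys
sorted-⊆-antisym {[]}     {[]}     _  _  _  _  = refl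
sorted-⊆-antisym {[]}     {y ∷ ys} _  _  _  ys⊆ with ys⊆ (here refl)
... | ()
sorted-⊆-antisym {x ∷ xs} {[]}     _  _  xs⊆ _ with xs⊆ (here refl)
... | ()
sorted-⊆-antisym {x ∷ xs} {y ∷ ys} sx sy xs⊆ ys⊆ =
  cong₂ _∷_ x≡y (sorted-⊆-antisym (Linked.tail sx) (Linked.tail sy) (shrink sx sy x≡y xs⊆) (shrink sy sx (sym x≡y) ys⊆))
  where
  x≡y : x ≡ y
  x≡y with xs⊆ (here refl) | ys⊆ (here refl)
  ... | here x≡y  | _         = x≡y
  ... | there _   | here y≡x  = sym y≡x
  ... | there y∈  | there x∈  = ⊥-elim (<-asym (sorted-head sy y∈) (sorted-head sx x∈))
  shrink : ∀ {a as b bs} → Sorted (a ∷ as) → Sorted (b ∷ bs) → a ≡ b → a ∷ as ⊆ b ∷ bs → as ⊆ bs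
  shrink sa sb refl as⊆ z∈ with as⊆ (there z∈)
  ... | there z∈′ = z∈′
  ... | here refl = ⊥-elim (sorted-head∉ sa z∈)

filterᵇ-sorted : ∀ (p : ℕ → Bool) {S} → Sorted S → Sorted (filterᵇ p S)
filterᵇ-sorted p = Linked-filter⁺ (T? ∘ p) <-trans

filterᵇ-memb : ∀ {S A} → Sorted S → Sorted A → A ⊆ S → filterᵇ (λ v → memb v A) S ≡ A
filterᵇ-memb {S} {A} sS sA A⊆S = sorted-⊆-antisym (filterᵇ-sorted _ sS) sA
  (λ v∈ → reflects-T⇒ (memb-reflects _ A) (proj₂ (∈-filter⁻ (T? ∘ λ v → memb v A) {xs = S} v∈)))
  (λ v∈ → ∈-filter⁺ (T? ∘ λ v → memb v A) (A⊆S v∈) (reflects-⇒T (memb-reflects _ A) v∈))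

filterᵇ-≡ᵇ : ∀ {x S} → Sorted S → x ∈ S → filterᵇ (_≡ᵇ x) S ≡ x ∷ []
filterᵇ-≡ᵇ {x} {S} sS x∈S = sorted-⊆-antisym (filterᵇ-sorted (_≡ᵇ x) sS) [-]
  (λ {v} v∈ → here (reflects-T⇒ (≡ᵇ-reflects v x) (proj₂ (∈-filter⁻ (T? ∘ (_≡ᵇ x)) {xs = S} v∈))))
  (λ { (here refl) → ∈-filter⁺ (T? ∘ (_≡ᵇ x)) x∈S (reflects-⇒T (≡ᵇ-reflects x x) refl) })

filterᵇ-cong : ∀ {A : Set} {p q : A → Bool} → (∀ v → p v ≡ q v) → ∀ S → filterᵇ p S ≡ filterᵇ q S
filterᵇ-cong p≗q []      = refl
filterᵇ-cong {p = p} {q} p≗q (v ∷ S) with p v | q v | p≗q v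
... | true  | _ | refl = cong (v ∷_) (filterᵇ-cong p≗q S)
... | false | _ | refl = filterᵇ-cong p≗q S

map-filterᵇ : ∀ {A : Set} (g : A → Block) (p : Block → Bool) S → map g (filterᵇ (λ v → p (g v)) S) ≡ filterᵇ p (map g S)
map-filterᵇ g p []      = refl
map-filterᵇ g p (v ∷ S) with p (g v)
... | true  = cong (g v ∷_) (map-filterᵇ g p S)
... | false = map-filterᵇ g p S

insertU-sorted-above : ∀ {b v} S → b < v → Sorted (b ∷ S) → Sorted (b ∷ insertU v S)
insertU-sorted-above         []       b<v _         = b<v ∷ [-]
insertU-sorted-above {v = v} (a ∷ as) b<v (b<a ∷ s) with v <ᵇ a | <ᵇ-reflects-< v a
... | true  | ofʸ v<a = b<v ∷ v<a ∷ s
... | false | ofⁿ v≮a with v ≡ᵇ a | ≡ᵇ-reflects v a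
...   | true  | _       = b<a ∷ s
...   | false | ofⁿ v≢a = b<a ∷ insertU-sorted-above as (≤∧≢⇒< (≮⇒≥ v≮a) (v≢a ∘ sym)) s

insertU-sorted : ∀ {v} S → Sorted S → Sorted (insertU v S)
insertU-sorted         []       _ = [-]
insertU-sorted {v = v} (a ∷ as) s with v <ᵇ a | <ᵇ-reflects-< v a
... | true  | ofʸ v<a = v<a ∷ s
... | false | ofⁿ v≮a with v ≡ᵇ a | ≡ᵇ-reflects v a
...   | true  | _       = s
...   | false | ofⁿ v≢a = insertU-sorted-above as (≤∧≢⇒< (≮⇒≥ v≮a) (v≢a ∘ sym)) s

insertU-⊆ : ∀ v S → insertU v S ⊆ v ∷ S
insertU-⊆ v []       z∈ = z∈
insertU-⊆ v (a ∷ as) z∈ with v <ᵇ a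
... | true = z∈
... | false with v ≡ᵇ a | ≡ᵇ-reflects v a
...   | true  | ofʸ refl = there z∈
...   | false | _ with z∈
...     | here z≡a  = there (here z≡a)
...     | there z∈′ with insertU-⊆ v as z∈′
...       | here z≡v    = here z≡v
...       | there z∈as  = there (there z∈as)

⊆-insertU : ∀ v S → v ∷ S ⊆ insertU v S
⊆-insertU v []       z∈ = z∈
⊆-insertU v (a ∷ as) z∈ with v <ᵇ a
... | true = z∈
... | false with v ≡ᵇ a | ≡ᵇ-reflects v a
...   | true  | ofʸ refl = [ here , id ]′ (Any.toSum z∈)
...   | false | _ with z∈
...     | here z≡v          = there (⊆-insertU v as (here z≡v))
...     | there (here z≡a)  = here z≡a
...     | there (there z∈′) = there (⊆-insertU v as (there z∈′))

toSortedSet : List ℕ → List ℕ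
toSortedSet = foldr insertU []

toSortedSet-sorted : ∀ xs → Sorted (toSortedSet xs)
toSortedSet-sorted []       = []
toSortedSet-sorted (x ∷ xs) = insertU-sorted (toSortedSet xs) (toSortedSet-sorted xs)

toSortedSet-⊆ : ∀ xs → toSortedSet xs ⊆ xs
toSortedSet-⊆ (x ∷ xs) z∈ with insertU-⊆ x (toSortedSet xs) z∈
... | here z≡x  = here z≡x
... | there z∈′ = there (toSortedSet-⊆ xs z∈′)

⊆-toSortedSet : ∀ xs → xs ⊆ toSortedSet xs
⊆-toSortedSet (x ∷ xs) (here z≡x) = ⊆-insertU x (toSortedSet xs) (here z≡x)
⊆-toSortedSet (x ∷ xs) (there z∈) = ⊆-insertU x (toSortedSet xs) (there (⊆-toSortedSet xs z∈))

IncreasingOn : (ℕ → ℕ) → List ℕ → Set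
IncreasingOn ρ S = ∀ {a b} → a ∈ S → b ∈ S → a < b → ρ a < ρ b

increasingOn-⊆ : ∀ {ρ S S′} → IncreasingOn ρ S → S′ ⊆ S → IncreasingOn ρ S′
increasingOn-⊆ ρ↑ S′⊆S a∈ b∈ = ρ↑ (S′⊆S a∈) (S′⊆S b∈)

increasingOn-injective : ∀ {ρ S} → IncreasingOn ρ S → ∀ {a b} → a ∈ S → b ∈ S → ρ a ≡ ρ b → a ≡ b
increasingOn-injective ρ↑ {a} {b} a∈ b∈ ρa≡ρb with <-cmp a b
... | tri< a<b _ _ = ⊥-elim (<-irrefl ρa≡ρb (ρ↑ a∈ b∈ a<b))
... | tri≈ _ a≡b _ = a≡b
... | tri> _ _ b<a = ⊥-elim (<-irrefl (sym ρa≡ρb) (ρ↑ b∈ a∈ b<a))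

map-sorted : ∀ {ρ} S → Sorted S → IncreasingOn ρ S → Sorted (map ρ S)
map-sorted []          _         _  = []
map-sorted (x ∷ [])    _         _  = [-]
map-sorted (x ∷ y ∷ S) (x<y ∷ s) ρ↑ =
  ρ↑ (here refl) (there (here refl)) x<y ∷ map-sorted (y ∷ S) s (increasingOn-⊆ ρ↑ there)

toSortedSet-map : ∀ {ρ} xs → IncreasingOn ρ xs → toSortedSet (map ρ xs) ≡ map ρ (toSortedSet xs)
toSortedSet-map {ρ} xs ρ↑ = sorted-⊆-antisym (toSortedSet-sorted (map ρ xs))
  (map-sorted (toSortedSet xs) (toSortedSet-sorted xs) (increasingOn-⊆ ρ↑ (toSortedSet-⊆ xs)))
  ⊆ˡ ⊆ʳ
  where
  ⊆ˡ : toSortedSet (map ρ xs) ⊆ map ρ (toSortedSet xs)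
  ⊆ˡ z∈ with ∈-map⁻ ρ (toSortedSet-⊆ (map ρ xs) z∈)
  ... | x , x∈ , refl = ∈-map⁺ ρ (⊆-toSortedSet xs x∈)
  ⊆ʳ : map ρ (toSortedSet xs) ⊆ toSortedSet (map ρ xs)
  ⊆ʳ z∈ with ∈-map⁻ ρ z∈
  ... | x , x∈ , refl = ⊆-toSortedSet (map ρ xs) (∈-map⁺ ρ (toSortedSet-⊆ xs x∈))

-- 0-based lookup, with junk value 0 out of range; rank (Defs) is 1-based.
at : List ℕ → ℕ → ℕ
at []       _       = 0
at (a ∷ _)  zero    = a
at (_ ∷ as) (suc i) = at as i

at-∈ : ∀ S {i} → i < length S → at S i ∈ S
at-∈ (a ∷ as) {zero}  _         = here refl
at-∈ (a ∷ as) {suc i} (s≤s i<) = there (at-∈ as i<)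

applyUpTo-at : ∀ S → applyUpTo (at S) (length S) ≡ S
applyUpTo-at []       = refl
applyUpTo-at (a ∷ as) = cong (a ∷_) (applyUpTo-at as)

map-applyUpTo : ∀ {A B : Set} (f : A → B) (g : ℕ → A) n → map f (applyUpTo g n) ≡ applyUpTo (λ i → f (g i)) n
map-applyUpTo f g zero    = refl
map-applyUpTo f g (suc n) = cong (f (g 0) ∷_) (map-applyUpTo f (λ i → g (suc i)) n)

rank-∈ : ∀ {v} S → v ∈ S → ∃[ i ] rank v S ≡ suc i × at S i ≡ v
rank-∈ {v} (x ∷ xs) v∈ with v ≡ᵇ x | ≡ᵇ-reflects v x
... | true  | ofʸ refl = 0 , refl , refl
... | false | ofⁿ v≢x with rank-∈ xs (Any.tail v≢x v∈)
...   | i , r≡ , at≡ = suc i , cong suc r≡ , at≡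

rank-at : ∀ S {i} → Sorted S → i < length S → rank (at S i) S ≡ suc i
rank-at (a ∷ as) {zero}  _ _ = cong (λ b → if b then 1 else suc (rank a as)) (≡ᵇ-refl a)
rank-at (a ∷ as) {suc i} s (s≤s i<) =
  trans (cong (λ b → if b then 1 else suc (rank (at as i) as)) (≢⇒≡ᵇ-false at≢a))
        (cong suc (rank-at as (Linked.tail s) i<))
  where
  at≢a : at as i ≢ a
  at≢a at≡a = <-irrefl (sym at≡a) (sorted-head s (at-∈ as i<))

rank-≡ᵇ : ∀ {v} S {i} → Sorted S → v ∈ S → i < length S → (rank v S ≡ᵇ suc i) ≡ (v ≡ᵇ at S i)
rank-≡ᵇ {v} S {i} s v∈ i< with v ≡ᵇ at S i | ≡ᵇ-reflects v (at S i)
... | true  | ofʸ refl = trans (cong (_≡ᵇ suc i) (rank-at S s i<)) (≡ᵇ-refl i)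
... | false | ofⁿ v≢at with rank-∈ S v∈
...   | j , r≡ , at≡ = ≢⇒≡ᵇ-false λ r≡i → v≢at (trans (sym at≡) (cong (λ k → at S (pred k)) (trans (sym r≡) r≡i)))

rank-increasing : ∀ {S} → Sorted S → IncreasingOn (λ v → rank v S) S
rank-increasing {x ∷ xs} s {a} {b} a∈ b∈ a<b with a ≡ᵇ x | ≡ᵇ-reflects a x | b ≡ᵇ x | ≡ᵇ-reflects b x
... | true  | ofʸ refl | true  | ofʸ refl = ⊥-elim (<-irrefl refl a<b)
... | true  | ofʸ refl | false | ofⁿ b≢x with rank-∈ xs (Any.tail b≢x b∈)
...   | _ , r≡ , _ = s≤s (subst (1 ≤_) (sym r≡) (s≤s z≤n))
rank-increasing {x ∷ xs} s a∈ b∈ a<b | false | ofⁿ a≢x | true  | ofʸ refl =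
  ⊥-elim (<-asym a<b (sorted-head s (Any.tail a≢x a∈)))
rank-increasing {x ∷ xs} s a∈ b∈ a<b | false | ofⁿ a≢x | false | ofⁿ b≢x =
  s≤s (rank-increasing (Linked.tail s) (Any.tail a≢x a∈) (Any.tail b≢x b∈) a<b)

rank-map : ∀ {ρ v} S → (∀ {a b} → a ∈ S → b ∈ S → ρ a ≡ ρ b → a ≡ b) → v ∈ S →
           rank (ρ v) (map ρ S) ≡ rank v S
rank-map {ρ} {v} (x ∷ xs) inj v∈ with v ≡ᵇ x | ≡ᵇ-reflects v x
... | true  | ofʸ refl = cong (λ b → if b then 1 else suc (rank (ρ v) (map ρ xs))) (≡ᵇ-refl (ρ v))
... | false | ofⁿ v≢x =
  trans (cong (λ b → if b then 1 else suc (rank (ρ v) (map ρ xs))) (≢⇒≡ᵇ-false (v≢x ∘ inj v∈ (here refl))))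
        (cong suc (rank-map xs (λ a∈ b∈ → inj (there a∈) (there b∈)) (Any.tail v≢x v∈)))

decode-encode : ∀ {acc} L → Sorted L → All (acc ≤_) L → decodeFrom acc (encodeFrom acc L) ≡ L
decode-encode         []       _ _            = refl
decode-encode {acc} (a ∷ as) s (acc≤a ∷ _) rewrite m+[n∸m]≡n acc≤a =
  cong (a ∷_) (decode-encode as (Linked.tail s) (tabulate (sorted-head s)))

decodeFrom-sorted : ∀ acc gs → Sorted (decodeFrom acc gs) × All (acc ≤_) (decodeFrom acc gs)
decodeFrom-sorted acc []       = [] , []
decodeFrom-sorted acc (g ∷ gs) with decodeFrom-sorted (suc (acc + g)) gs
... | s , above = sorted-∷ (All.lookup above) s , m≤m+n acc g ∷ All.map (≤-trans (m≤m+n acc g) ∘ <⇒≤) above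

thetaIdx-sorted : ∀ u → Sorted (thetaIdx u)
thetaIdx-sorted u = proj₁ (decodeFrom-sorted 0 (proj₁ u))

thetaIdx-mkMono : ∀ {A} a → Sorted A → thetaIdx (mkMono A a) ≡ A
thetaIdx-mkMono {A} a s = decode-encode A s (All.tabulate λ _ → z≤n)

degree-mkMono : ∀ A a → degree (mkMono A a) ≡ length A + length a
degree-mkMono A a = cong (_+ length a) (trans (length-decodeFrom 0 (encode A)) (length-encodeFrom 0 A))
  where
  length-decodeFrom : ∀ acc gs → length (decodeFrom acc gs) ≡ length gs
  length-decodeFrom acc []       = refl
  length-decodeFrom acc (g ∷ gs) = cong suc (length-decodeFrom (suc (acc + g)) gs)
  length-encodeFrom : ∀ acc L → length (encodeFrom acc L) ≡ length L
  length-encodeFrom acc []       = refl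
  length-encodeFrom acc (a ∷ L) = cong suc (length-encodeFrom (suc a) L)

letters : List ℕ → List ℕ → List ℕ
letters T X = toSortedSet (T ++ X)

standardize : List ℕ → List ℕ → ℕ → ℕ
standardize T X v = rank v (letters T X)

standardize-increasing : ∀ T X → IncreasingOn (standardize T X) (T ++ X)
standardize-increasing T X a∈ b∈ =
  rank-increasing (toSortedSet-sorted (T ++ X)) (⊆-toSortedSet (T ++ X) a∈) (⊆-toSortedSet (T ++ X) b∈)

stdOf : List ℕ → List ℕ → Mono
stdOf T X = mkMono (map (standardize T X) T) (map (standardize T X) X)

stdOf-relabel : ∀ T X ρ → IncreasingOn ρ (T ++ X) → stdOf (map ρ T) (map ρ X) ≡ stdOf T X
stdOf-relabel T X ρ ρ↑ = cong₂ mkMono (relabel T (xs⊆xs++ys T X)) (relabel X (xs⊆ys++xs X T))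
  where
  S = letters T X
  letters≡ : letters (map ρ T) (map ρ X) ≡ map ρ S
  letters≡ = trans (cong toSortedSet (sym (map-++ ρ T X))) (toSortedSet-map (T ++ X) ρ↑)
  relabel : ∀ L → L ⊆ T ++ X → map (standardize (map ρ T) (map ρ X)) (map ρ L) ≡ map (standardize T X) L
  relabel L L⊆ = trans (sym (map-∘ L)) (map-cong-∈ L λ {v} v∈ →
    trans (cong (rank (ρ v)) letters≡)
          (rank-map S (increasingOn-injective (increasingOn-⊆ ρ↑ (toSortedSet-⊆ (T ++ X))))
                      (⊆-toSortedSet (T ++ X) (L⊆ v∈))))

std-relabel : ∀ {A} a ρ → Sorted A → IncreasingOn ρ (A ++ a) → std (mkMono (map ρ A) (map ρ a)) ≡ std (mkMono A a)
std-relabel {A} a ρ sA ρ↑ = begin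
  std (mkMono (map ρ A) (map ρ a))
    ≡⟨ cong (λ T → stdOf T (map ρ a)) (thetaIdx-mkMono (map ρ a) (map-sorted A sA (increasingOn-⊆ ρ↑ (xs⊆xs++ys A a)))) ⟩
  stdOf (map ρ A) (map ρ a)        ≡⟨ stdOf-relabel A a ρ ρ↑ ⟩
  stdOf A a                        ≡⟨ cong (λ T → stdOf T a) (thetaIdx-mkMono a sA) ⟨
  std (mkMono A a)                 ∎
  where open ≡-Reasoning

-- The blocks of I(u), letter by letter

mkBlock : Bool → List ℕ → Block
mkBlock f ps = (if f then 0 ∷ [] else []) ++ ps

Positive : List ℕ → Set
Positive = All (0 <_)

fermionic-mkBlock : ∀ f {ps} → Positive ps → fermionic (mkBlock f ps) ≡ f
fermionic-mkBlock true  _                     = refl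
fermionic-mkBlock false []                    = refl
fermionic-mkBlock false {suc _ ∷ _} (_ ∷ pos) = fermionic-mkBlock false pos

positives-mkBlock : ∀ f {ps} → Positive ps → positives (mkBlock f ps) ≡ ps
positives-mkBlock true  pos = filter-all (0 <?_) pos
positives-mkBlock false pos = filter-all (0 <?_) pos

unionB-mkBlock : ∀ f g {ps qs} → Positive ps → Positive qs → unionB (mkBlock f ps) (mkBlock g qs) ≡ mkBlock (f ∨ g) (ps ++ qs)
unionB-mkBlock f g pos qos
  rewrite fermionic-mkBlock f pos | fermionic-mkBlock g qos | positives-mkBlock f pos | positives-mkBlock g qos = refl

nonEmpty : List ℕ → Bool
nonEmpty []      = false
nonEmpty (_ ∷ _) = true

nonEmpty-mkBlock : ∀ f ps → nonEmpty (mkBlock f ps) ≡ f ∨ nonEmpty ps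
nonEmpty-mkBlock true  ps      = refl
nonEmpty-mkBlock false []      = refl
nonEmpty-mkBlock false (_ ∷ _) = refl

letterBlock : List ℕ → List ℕ → ℕ → Block
letterBlock T X v = mkBlock (memb v T) (positionsFrom 1 v X)

memb-map : ∀ r s ρ L → (∀ {v} → v ∈ L → (r ≡ᵇ ρ v) ≡ (s ≡ᵇ v)) → memb r (map ρ L) ≡ memb s L
memb-map r s ρ []      _  = refl
memb-map r s ρ (x ∷ L) eq = cong₂ _∨_ (eq (here refl)) (memb-map r s ρ L (eq ∘ there))

positionsFrom-map : ∀ r s t ρ L → (∀ {v} → v ∈ L → (r ≡ᵇ ρ v) ≡ (s ≡ᵇ v)) →
                    positionsFrom t r (map ρ L) ≡ positionsFrom t s L
positionsFrom-map r s t ρ []      _  = refl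
positionsFrom-map r s t ρ (x ∷ L) eq rewrite eq (here refl) with s ≡ᵇ x
... | true  = cong (t ∷_) (positionsFrom-map r s (suc t) ρ L (eq ∘ there))
... | false = positionsFrom-map r s (suc t) ρ L (eq ∘ there)

sscOf-letterwise : ∀ u → sscOf u ≡ map (letterBlock (thetaIdx u) (xWord u)) (ind u)
sscOf-letterwise u = begin
  map (λ r → mkBlock (memb r (thetaIdx (std u))) (positionsFrom 1 r (xWord (std u)))) (applyUpTo suc k)
    ≡⟨ map-cong-∈ (applyUpTo suc k) block≡ ⟩
  map (λ r → B (at S (pred r))) (applyUpTo suc k)  ≡⟨ map-applyUpTo _ suc k ⟩
  applyUpTo (λ i → B (at S i)) k                           ≡⟨ map-applyUpTo B (at S) k ⟨
  map B (applyUpTo (at S) k)                               ≡⟨ cong (map B) (applyUpTo-at S) ⟩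
  map B S                                                  ∎
  where
  open ≡-Reasoning
  Θ = thetaIdx u
  X = xWord u
  S = letters Θ X
  k = length S
  B = letterBlock Θ X
  ρ = standardize Θ X
  block≡ : ∀ {r} → r ∈ applyUpTo suc k →
           mkBlock (memb r (thetaIdx (std u))) (positionsFrom 1 r (xWord (std u))) ≡ B (at S (pred r))
  block≡ r∈ with ∈-applyUpTo⁻ suc r∈
  ... | i , i<k , refl =
    cong₂ mkBlock (trans (cong (memb (suc i)) θ≡) (memb-map (suc i) (at S i) ρ Θ (≡ᵇ-at ∘ xs⊆xs++ys Θ X)))
                  (positionsFrom-map (suc i) (at S i) 1 ρ X (≡ᵇ-at ∘ xs⊆ys++xs X Θ))
    where
    θ≡ : thetaIdx (std u) ≡ map ρ Θ
    θ≡ = thetaIdx-mkMono (map ρ X) (map-sorted Θ (thetaIdx-sorted u) (increasingOn-⊆ (standardize-increasing Θ X) (xs⊆xs++ys Θ X)))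
    ≡ᵇ-at : ∀ {v} → v ∈ Θ ++ X → (suc i ≡ᵇ ρ v) ≡ (at S i ≡ᵇ v)
    ≡ᵇ-at {v} v∈ = trans (≡ᵇ-sym (suc i) (ρ v))
      (trans (rank-≡ᵇ S (toSortedSet-sorted (Θ ++ X)) (⊆-toSortedSet (Θ ++ X) v∈) i<k) (≡ᵇ-sym v (at S i)))

positionsFrom-take-drop : ∀ t v n X → positionsFrom t v X ≡ positionsFrom t v (take n X) ++ positionsFrom (t + n) v (drop n X)
positionsFrom-take-drop t v zero    X       = cong (λ s → positionsFrom s v X) (sym (+-identityʳ t))
positionsFrom-take-drop t v (suc n) []      = refl
positionsFrom-take-drop t v (suc n) (x ∷ X) rewrite +-suc t n with v ≡ᵇ x
... | true  = cong (t ∷_) (positionsFrom-take-drop (suc t) v n X)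
... | false = positionsFrom-take-drop (suc t) v n X

positionsFrom-bounds : ∀ t v X → All (λ p → t ≤ p × p < t + length X) (positionsFrom t v X)
positionsFrom-bounds t v []      = []
positionsFrom-bounds t v (x ∷ X) = cons? (v ≡ᵇ x) (All.map widen (positionsFrom-bounds (suc t) v X))
  where
  InRange = λ p → t ≤ p × p < t + length (x ∷ X)
  widen : ∀ {p} → suc t ≤ p × p < suc t + length X → InRange p
  widen {p} (t<p , p<) = <⇒≤ t<p , subst (p <_) (sym (+-suc t (length X))) p<
  cons? : ∀ b {ps} → All InRange ps → All InRange (if b then t ∷ ps else ps)
  cons? true  inRange = (≤-refl , m<m+n t (s≤s z≤n)) ∷ inRange
  cons? false inRange = inRange

positionsFrom-positive : ∀ t v X → Positive (positionsFrom (suc t) v X)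
positionsFrom-positive t v X = All.map (λ (t<p , _) → ≤-<-trans z≤n t<p) (positionsFrom-bounds (suc t) v X)

nonEmpty-positionsFrom : ∀ t v X → Reflects (v ∈ X) (nonEmpty (positionsFrom t v X))
nonEmpty-positionsFrom t v []      = ofⁿ λ ()
nonEmpty-positionsFrom t v (x ∷ X) with v ≡ᵇ x | ≡ᵇ-reflects v x
... | true  | ofʸ v≡x = ofʸ (here v≡x)
... | false | ofⁿ v≢x with nonEmpty (positionsFrom (suc t) v X) | nonEmpty-positionsFrom (suc t) v X
...   | true  | ofʸ v∈X = ofʸ (there v∈X)
...   | false | ofⁿ v∉X = ofⁿ λ { (here v≡x) → v≢x v≡x ; (there v∈X) → v∉X v∈X }

nonEmpty-letterBlock : ∀ T X v → Reflects (v ∈ T ⊎ v ∈ X) (nonEmpty (letterBlock T X v))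
nonEmpty-letterBlock T X v = subst (Reflects _) (sym (nonEmpty-mkBlock (memb v T) (positionsFrom 1 v X)))
  (memb-reflects v T ⊎-reflects nonEmpty-positionsFrom 1 v X)

blocksOf : (ℕ → List ℕ) → List ℕ → List ℕ → SSC
blocksOf pos A S = filterᵇ nonEmpty (map (λ v → mkBlock (memb v A) (pos v)) S)

sscOf-mkMono : ∀ {A S} x → Sorted A → Sorted S → A ⊆ S → x ⊆ S →
               sscOf (mkMono A x) ≡ blocksOf (λ v → positionsFrom 1 v x) A S
sscOf-mkMono {A} {S} x sA sS A⊆S x⊆S = begin
  sscOf (mkMono A x)                        ≡⟨ sscOf-letterwise (mkMono A x) ⟩
  map (letterBlock A′ x) (letters A′ x)     ≡⟨ cong (λ T → map (letterBlock T x) (letters T x)) (thetaIdx-mkMono x sA) ⟩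
  map g (letters A x)                       ≡⟨ cong (map g) letters≡ ⟩
  map g (filterᵇ (λ v → nonEmpty (g v)) S)  ≡⟨ map-filterᵇ g nonEmpty S ⟩
  blocksOf (λ v → positionsFrom 1 v x) A S  ∎
  where
  open ≡-Reasoning
  A′ = thetaIdx (mkMono A x)
  g = letterBlock A x
  letters≡ : letters A x ≡ filterᵇ (λ v → nonEmpty (g v)) S
  letters≡ = sorted-⊆-antisym (toSortedSet-sorted (A ++ x)) (filterᵇ-sorted _ sS)
    (λ {v} v∈ → let v∈A⊎x = ∈-++⁻ A (toSortedSet-⊆ (A ++ x) v∈) in
      ∈-filter⁺ (T? ∘ λ v → nonEmpty (g v)) ([ A⊆S , x⊆S ]′ v∈A⊎x) (reflects-⇒T (nonEmpty-letterBlock A x v) v∈A⊎x))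
    (λ {v} v∈ → ⊆-toSortedSet (A ++ x)
      ([ ∈-++⁺ˡ , ∈-++⁺ʳ A ]′
        (reflects-T⇒ (nonEmpty-letterBlock A x v) (proj₂ (∈-filter⁻ (T? ∘ λ v → nonEmpty (g v)) {xs = S} v∈)))))

sum-length-positionsFrom : ∀ X t {S} → Sorted S → X ⊆ S → sum (map (λ v → length (positionsFrom t v X)) S) ≡ length X
sum-length-positionsFrom []      t {S} _  _   = sum-zeros S
  where
  sum-zeros : ∀ S → sum (map (λ _ → 0) S) ≡ 0
  sum-zeros []      = refl
  sum-zeros (_ ∷ S) = sum-zeros S
sum-length-positionsFrom (x ∷ X) t {S} sS X⊆S = begin
  sum (map (λ v → length (positionsFrom t v (x ∷ X))) S)
    ≡⟨ cong sum (map-cong (λ v → length-if (v ≡ᵇ x)) S) ⟩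
  sum (map (λ v → (if v ≡ᵇ x then 1 else 0) + length (positionsFrom (suc t) v X)) S)
    ≡⟨ sum-map-+ (λ v → if v ≡ᵇ x then 1 else 0) _ S ⟩
  sum (map (λ v → if v ≡ᵇ x then 1 else 0) S) + sum (map (λ v → length (positionsFrom (suc t) v X)) S)
    ≡⟨ cong₂ _+_ (trans (sum-map-indicator (_≡ᵇ x) S) (cong length (filterᵇ-≡ᵇ sS (X⊆S (here refl)))))
                 (sum-length-positionsFrom X (suc t) sS (X⊆S ∘ there)) ⟩
  suc (length X) ∎
  where
  open ≡-Reasoning
  length-if : ∀ b {ps} → length (if b then t ∷ ps else ps) ≡ (if b then 1 else 0) + length ps
  length-if true  = refl
  length-if false = refl

bidegN-sscOf : ∀ u → bidegN (sscOf u) ≡ length (xWord u)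
bidegN-sscOf u = begin
  length (concatMap positives (sscOf u))
    ≡⟨ cong (λ K → length (concatMap positives K)) (sscOf-letterwise u) ⟩
  length (concatMap positives (map (letterBlock Θ X) S))
    ≡⟨ length-concatMap positives (map (letterBlock Θ X) S) ⟩
  sum (map (λ b → length (positives b)) (map (letterBlock Θ X) S))
    ≡⟨ cong sum (trans (sym (map-∘ S)) (map-cong (λ v → cong length (positives-mkBlock (memb v Θ) (positionsFrom-positive 0 v X))) S)) ⟩
  sum (map (λ v → length (positionsFrom 1 v X)) S)
    ≡⟨ sum-length-positionsFrom X 1 (toSortedSet-sorted (Θ ++ X)) (⊆-toSortedSet (Θ ++ X) ∘ ∈-++⁺ʳ Θ) ⟩
  length X ∎
  where
  open ≡-Reasoning
  Θ = thetaIdx u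
  X = xWord u
  S = letters Θ X

θSplit : Set
θSplit = List ℕ × List ℕ × ℕ

productTerm : Series → Series → θSplit → List ℕ × List ℕ → ℚ
productTerm f g (A , B , c) (a , b) = sgnℚ c *ℚ (f (mkMono A a) *ℚ g (mkMono B b))

productAt : Series → Series → List ℕ → List ℕ → ℚ
productAt f g T X = sumℚ (concatMap (λ t → map (productTerm f g t) (splitsX X)) (splitsθ T))

record Interleaving (T A B : List ℕ) : Set where
  field
    sortedˡ  : Sorted A
    sortedʳ  : Sorted B
    ⊆ˡ       : A ⊆ T
    ⊆ʳ       : B ⊆ T
    length-+ : length A + length B ≡ length T

splitsθ-interleaving : ∀ {T A B c} → Sorted T → (A , B , c) ∈ splitsθ T → Interleaving T A B
splitsθ-interleaving {[]} _ (here refl) =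
  record { sortedˡ = [] ; sortedʳ = [] ; ⊆ˡ = λ () ; ⊆ʳ = λ () ; length-+ = refl }
splitsθ-interleaving {t ∷ T} s t∈ with find (∈-concatMap⁻ _ {xs = splitsθ T} t∈)
... | (A , B , c) , p∈ , p∈′ with splitsθ-interleaving (Linked.tail s) p∈ | p∈′
...   | I | here refl = record
  { sortedˡ = sorted-∷ (sorted-head s ∘ ⊆ˡ) sortedˡ ; sortedʳ = sortedʳ
  ; ⊆ˡ = ∷⁺ʳ t ⊆ˡ ; ⊆ʳ = there ∘ ⊆ʳ ; length-+ = cong suc length-+ }
  where open Interleaving I
...   | I | there (here refl) = record
  { sortedˡ = sortedˡ ; sortedʳ = sorted-∷ (sorted-head s ∘ ⊆ʳ) sortedʳ
  ; ⊆ˡ = there ∘ ⊆ˡ ; ⊆ʳ = ∷⁺ʳ t ⊆ʳ ; length-+ = trans (+-suc _ _) (cong suc length-+) }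
  where open Interleaving I

splitsX-++ : ∀ {X a b} → (a , b) ∈ splitsX X → a ++ b ≡ X
splitsX-++ {[]}    (here refl) = refl
splitsX-++ {x ∷ X} (here refl) = refl
splitsX-++ {x ∷ X} (there p∈) with ∈-map⁻ _ p∈
... | (a , b) , p∈′ , refl = cong (x ∷_) (splitsX-++ p∈′)

mapSplit : (ℕ → ℕ) → θSplit → θSplit
mapSplit ρ (A , B , c) = map ρ A , map ρ B , c

splitsθ-map : ∀ ρ T → splitsθ (map ρ T) ≡ map (mapSplit ρ) (splitsθ T)
splitsθ-map ρ []       = refl
splitsθ-map ρ (t ∷ ts) rewrite splitsθ-map ρ ts =
  trans (concatMap-map _ (mapSplit ρ) (splitsθ ts))
        (trans (concatMap-cong step (splitsθ ts)) (sym (map-concatMap (mapSplit ρ) _ (splitsθ ts))))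
  where
  step : ∀ ((A , B , c) : θSplit) →
         (ρ t ∷ map ρ A , map ρ B , c) ∷ (map ρ A , ρ t ∷ map ρ B , c + length (map ρ A)) ∷ []
         ≡ mapSplit ρ (t ∷ A , B , c) ∷ mapSplit ρ (A , t ∷ B , c + length A) ∷ []
  step (A , B , c) = cong (λ l → (ρ t ∷ map ρ A , map ρ B , c) ∷ (map ρ A , ρ t ∷ map ρ B , c + l) ∷ []) (length-map ρ A)

splitsX-map : ∀ ρ X → splitsX (map ρ X) ≡ map (λ (a , b) → map ρ a , map ρ b) (splitsX X)
splitsX-map ρ []       = refl
splitsX-map ρ (x ∷ xs) = cong (([] , ρ x ∷ map ρ xs) ∷_)
  (trans (cong (map _) (splitsX-map ρ xs)) (trans (sym (map-∘ (splitsX xs))) (map-∘ (splitsX xs))))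

splitsX-pick : ∀ n X (h : List ℕ × List ℕ → ℚ) → (∀ a b → length a ≢ n → h (a , b) ≡ 0ℚ) →
               sumℚ (map h (splitsX X)) ≡ h (take n X , drop n X)
splitsX-pick zero    []      h h≡0 = ℚ.+-identityʳ _
splitsX-pick (suc n) []      h h≡0 = trans (ℚ.+-identityʳ _) (trans (h≡0 [] [] λ ()) (sym (h≡0 [] [] λ ())))
splitsX-pick zero    (x ∷ X) h h≡0 =
  trans (cong (h ([] , x ∷ X) +ℚ_) (trans (sumℚ-map-map h _ (splitsX X)) (sumℚ-map-zero (splitsX X) λ _ → h≡0 _ _ λ ())))
        (ℚ.+-identityʳ _)
splitsX-pick (suc n) (x ∷ X) h h≡0 =
  trans (cong₂ _+ℚ_ (h≡0 [] (x ∷ X) λ ())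
                    (trans (sumℚ-map-map h _ (splitsX X))
                           (splitsX-pick n X (λ (a , b) → h (x ∷ a , b)) λ a b |a|≢n → h≡0 (x ∷ a) b (|a|≢n ∘ suc-injective))))
        (ℚ.+-identityˡ _)

productTerm-zeroˡ : ∀ f g {A B c a b} → f (mkMono A a) ≡ 0ℚ → productTerm f g (A , B , c) (a , b) ≡ 0ℚ
productTerm-zeroˡ f g {B = B} {c} {b = b} f≡0 =
  trans (cong (λ z → sgnℚ c *ℚ (z *ℚ g (mkMono B b))) f≡0)
        (trans (cong (sgnℚ c *ℚ_) (ℚ.*-zeroˡ (g (mkMono B b)))) (ℚ.*-zeroʳ (sgnℚ c)))

productTerm-zeroʳ : ∀ f g {A B c a b} → g (mkMono B b) ≡ 0ℚ → productTerm f g (A , B , c) (a , b) ≡ 0ℚ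
productTerm-zeroʳ f g {A} {c = c} {a} g≡0 =
  trans (cong (λ z → sgnℚ c *ℚ (f (mkMono A a) *ℚ z)) g≡0)
        (trans (cong (sgnℚ c *ℚ_) (ℚ.*-zeroʳ (f (mkMono A a)))) (ℚ.*-zeroʳ (sgnℚ c)))

-- sNCQSym is a subalgebra

StdInvariant : Series → Set
StdInvariant f = ∀ u v → std u ≡ std v → f u ≡ f v

productAt-relabel : ∀ f g → StdInvariant f → StdInvariant g → ∀ T X ρ → Sorted T → IncreasingOn ρ (T ++ X) →
                    productAt f g (map ρ T) (map ρ X) ≡ productAt f g T X
productAt-relabel f g f-inv g-inv T X ρ sT ρ↑ rewrite splitsθ-map ρ T | splitsX-map ρ X =
  cong sumℚ (trans (concatMap-map _ (mapSplit ρ) (splitsθ T))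
    (cong concat (map-cong-∈ (splitsθ T) λ {(A , B , c)} t∈ → trans (sym (map-∘ (splitsX X)))
      (map-cong-∈ (splitsX X) λ {(a , b)} p∈ → term-relabel A B c a b (splitsθ-interleaving sT t∈) (splitsX-++ p∈)))))
  where
  term-relabel : ∀ A B c a b → Interleaving T A B → a ++ b ≡ X →
                 productTerm f g (map ρ A , map ρ B , c) (map ρ a , map ρ b) ≡ productTerm f g (A , B , c) (a , b)
  term-relabel A B c a b I refl = cong₂ (λ x y → sgnℚ c *ℚ (x *ℚ y))
    (f-inv _ _ (std-relabel a ρ sortedˡ (increasingOn-⊆ ρ↑ (++⁺ ⊆ˡ (xs⊆xs++ys a b)))))
    (g-inv _ _ (std-relabel b ρ sortedʳ (increasingOn-⊆ ρ↑ (++⁺ ⊆ʳ (xs⊆ys++xs b a)))))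
    where open Interleaving I

·-std : ∀ f g → StdInvariant f → StdInvariant g → ∀ u → (f · g) (std u) ≡ (f · g) u
·-std f g f-inv g-inv u = begin
  productAt f g (thetaIdx (std u)) (map ρ X) ≡⟨ cong (λ T′ → productAt f g T′ (map ρ X)) θ≡ ⟩
  productAt f g (map ρ Θ) (map ρ X)          ≡⟨ productAt-relabel f g f-inv g-inv Θ X ρ (thetaIdx-sorted u) (standardize-increasing Θ X) ⟩
  productAt f g Θ X                          ∎
  where
  open ≡-Reasoning
  Θ = thetaIdx u
  X = xWord u
  ρ = standardize Θ X
  θ≡ : thetaIdx (std u) ≡ map ρ Θ
  θ≡ = thetaIdx-mkMono (map ρ X) (map-sorted Θ (thetaIdx-sorted u) (increasingOn-⊆ (standardize-increasing Θ X) (xs⊆xs++ys Θ X)))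

·-stdInvariant : ∀ f g → StdInvariant f → StdInvariant g → StdInvariant (f · g)
·-stdInvariant f g f-inv g-inv u v std≡ =
  trans (sym (·-std f g f-inv g-inv u)) (trans (cong (f · g) std≡) (·-std f g f-inv g-inv v))

·-boundedDegree : ∀ f g → BoundedDegree f → BoundedDegree g → BoundedDegree (f · g)
·-boundedDegree f g (d₁ , f≡0) (d₂ , g≡0) = d₁ + d₂ , λ u d< → sumℚ-zero (tabulate (term≡0 u d<))
  where
  term≡0 : ∀ u → d₁ + d₂ < degree u → ∀ {q} →
           q ∈ concatMap (λ t → map (productTerm f g t) (splitsX (xWord u))) (splitsθ (thetaIdx u)) → q ≡ 0ℚ
  term≡0 u d< q∈ with find (∈-concatMap⁻ _ {xs = splitsθ (thetaIdx u)} q∈)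
  ... | (A , B , c) , t∈ , q∈′ with ∈-map⁻ _ q∈′
  ...   | (a , b) , p∈ , refl with d₁ <? degree (mkMono A a) | d₂ <? degree (mkMono B b)
  ...     | yes d₁< | _       = productTerm-zeroˡ f g {A} {B} {c} {a} {b} (f≡0 _ d₁<)
  ...     | no _    | yes d₂< = productTerm-zeroʳ f g {A} {B} {c} {a} {b} (g≡0 _ d₂<)
  ...     | no d₁≮  | no d₂≮  = ⊥-elim (<⇒≱ d< (subst (_≤ d₁ + d₂) degree≡ (+-mono-≤ (≮⇒≥ d₁≮) (≮⇒≥ d₂≮))))
    where
    open Interleaving (splitsθ-interleaving (thetaIdx-sorted u) t∈)
    degree≡ : degree (mkMono A a) + degree (mkMono B b) ≡ degree u
    degree≡ rewrite degree-mkMono A a | degree-mkMono B b =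
      trans (+-interchange (length A) (length a) (length B) (length b))
            (cong₂ _+_ length-+ (trans (sym (length-++ a)) (cong length (splitsX-++ p∈))))

oneS-sNCQSym : InSNCQSym oneS
oneS-sNCQSym = (0 , vanish) , λ u v std≡ → trans (sym (oneS-std u)) (trans (cong oneS std≡) (oneS-std v))
  where
  vanish : ∀ u → 0 < degree u → oneS u ≡ 0ℚ
  vanish ([]    , [])    ()
  vanish ([]    , _ ∷ _) _ = refl
  vanish (_ ∷ _ , _)     _ = refl
  oneS-std : ∀ u → oneS (std u) ≡ oneS u
  oneS-std ([]    , [])    = refl
  oneS-std ([]    , _ ∷ _) = refl
  oneS-std (_ ∷ _ , _)     = refl

⊕-sNCQSym : ∀ f g → InSNCQSym f → InSNCQSym g → InSNCQSym (f ⊕ g)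
⊕-sNCQSym f g ((d₁ , f≡0) , f-inv) ((d₂ , g≡0) , g-inv) =
  (d₁ ⊔ d₂ , λ u d< → cong₂ _+ℚ_ (f≡0 u (≤-<-trans (m≤m⊔n d₁ d₂) d<)) (g≡0 u (≤-<-trans (m≤n⊔m d₁ d₂) d<))) ,
  λ u v std≡ → cong₂ _+ℚ_ (f-inv u v std≡) (g-inv u v std≡)

⊙-sNCQSym : ∀ q f → InSNCQSym f → InSNCQSym (q ⊙ f)
⊙-sNCQSym q f ((d , f≡0) , f-inv) =
  (d , λ u d< → trans (cong (q *ℚ_) (f≡0 u d<)) (ℚ.*-zeroʳ q)) , λ u v std≡ → cong (q *ℚ_) (f-inv u v std≡)

·-sNCQSym : ∀ f g → InSNCQSym f → InSNCQSym g → InSNCQSym (f · g)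
·-sNCQSym f g (f-bd , f-inv) (g-bd , g-inv) = ·-boundedDegree f g f-bd g-bd , ·-stdInvariant f g f-inv g-inv

-- Counting quasi-shuffles

eqB : Block → Block → Bool
eqB b c = does (≡-dec _≟_ b c)

eqK : SSC → SSC → Bool
eqK K K′ = does (K ≟SSC K′)

eqB-reflects : ∀ b c → Reflects (b ≡ c) (eqB b c)
eqB-reflects b c = proof (≡-dec _≟_ b c)

eqK-reflects : ∀ K K′ → Reflects (K ≡ K′) (eqK K K′)
eqK-reflects K K′ = proof (K ≟SSC K′)

count : SSC → List SSC → ℚ
count K Ks = sumℚ (map (λ K′ → ⟦ eqK K K′ ⟧) Ks)

count-++ : ∀ K Ks Ks′ → count K (Ks ++ Ks′) ≡ count K Ks +ℚ count K Ks′
count-++ K = sumℚ-map-++ (λ K′ → ⟦ eqK K K′ ⟧)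

count-∷ : ∀ k K b Ks → count (k ∷ K) (map (b ∷_) Ks) ≡ ⟦ eqB k b ⟧ *ℚ count K Ks
count-∷ k K b Ks = trans (sumℚ-map-map _ (b ∷_) Ks)
  (trans (cong sumℚ (map-cong (λ K′ → ⟦∧⟧ (eqB k b) (eqK K K′)) Ks)) (sumℚ-map-*ˡ ⟦ eqB k b ⟧ _ Ks))

count-[]-∷ : ∀ b Ks → count [] (map (b ∷_) Ks) ≡ 0ℚ
count-[]-∷ b []       = refl
count-[]-∷ b (_ ∷ Ks) = trans (ℚ.+-identityˡ _) (count-[]-∷ b Ks)

mergeCount : List TBlock → SSC → ℚ
mergeCount L K = count K (merges L)

signedCount : List (List TBlock × ℕ) → SSC → ℚ
signedCount S K = sumℚ (map (λ (L , e) → sgnℚ e *ℚ mergeCount L K) S)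

qshCount : SSC → SSC → SSC → ℚ
qshCount P Q = signedCount (shuffles P Q)

qshSum≡qshCount : ∀ I J w → qshSum I J w ≡ qshCount I (shift (bidegN I) J) (sscOf w)
qshSum≡qshCount I J w =
  trans (cong sumℚ (map-concatMap _ _ (shuffles I (shift (bidegN I) J))))
  (trans (sumℚ-concatMap _ (shuffles I (shift (bidegN I) J)))
  (cong sumℚ (map-cong (λ (L , e) → trans (sumℚ-map-map _ _ (merges L)) (sumℚ-map-*ˡ (sgnℚ e) _ (merges L)))
                       (shuffles I (shift (bidegN I) J)))))

Mergeable : Bool → Block → Bool → Block → Bool
Mergeable s b t c = s ∧ not t ∧ not (fermionic b ∧ fermionic c)

mergeTerm : Bool → Block → List TBlock → Block → SSC → ℚ
mergeTerm s b []              k K = 0ℚ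
mergeTerm s b ((t , c) ∷ L) k K = if Mergeable s b t c then ⟦ eqB k (unionB b c) ⟧ *ℚ mergeCount L K else 0ℚ

mergeCount-∷ : ∀ s b L k K → mergeCount ((s , b) ∷ L) (k ∷ K) ≡ ⟦ eqB k b ⟧ *ℚ mergeCount L K +ℚ mergeTerm s b L k K
mergeCount-∷ s b []            k K = trans (ℚ.+-identityʳ _) (trans (⟦∧⟧ (eqB k b) (eqK K []))
  (sym (trans (ℚ.+-identityʳ _) (cong (⟦ eqB k b ⟧ *ℚ_) (ℚ.+-identityʳ _)))))
mergeCount-∷ s b ((t , c) ∷ L) k K with Mergeable s b t c
... | true  = trans (count-++ (k ∷ K) (map (b ∷_) (merges ((t , c) ∷ L))) (map (unionB b c ∷_) (merges L)))
                    (cong₂ _+ℚ_ (count-∷ k K b (merges ((t , c) ∷ L))) (count-∷ k K (unionB b c) (merges L)))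
... | false = trans (count-++ (k ∷ K) (map (b ∷_) (merges ((t , c) ∷ L))) [])
                    (cong (_+ℚ 0ℚ) (count-∷ k K b (merges ((t , c) ∷ L))))

mergeCount-[] : ∀ s b L → mergeCount ((s , b) ∷ L) [] ≡ 0ℚ
mergeCount-[] s b []            = refl
mergeCount-[] s b ((t , c) ∷ L) with Mergeable s b t c
... | true  = trans (count-++ [] (map (b ∷_) (merges ((t , c) ∷ L))) (map (unionB b c ∷_) (merges L)))
                    (trans (cong₂ _+ℚ_ (count-[]-∷ b (merges ((t , c) ∷ L))) (count-[]-∷ (unionB b c) (merges L))) (ℚ.+-identityˡ 0ℚ))
... | false = trans (count-++ [] (map (b ∷_) (merges ((t , c) ∷ L))) [])
                    (trans (cong (_+ℚ 0ℚ) (count-[]-∷ b (merges ((t , c) ∷ L)))) (ℚ.+-identityˡ 0ℚ))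

⟦eqB⟧-transport : ∀ k y (g : Block → ℚ) → ⟦ eqB k y ⟧ *ℚ g y ≡ ⟦ eqB k y ⟧ *ℚ g k
⟦eqB⟧-transport k y g with eqB k y | eqB-reflects k y
... | true  | ofʸ refl = refl
... | false | _        = trans (ℚ.*-zeroˡ (g y)) (sym (ℚ.*-zeroˡ (g k)))

signedCount-shift : ∀ S d a K →
  sumℚ (map (λ (L , e) → sgnℚ (e + d) *ℚ (a *ℚ mergeCount L K)) S) ≡ sgnℚ d *ℚ (a *ℚ signedCount S K)
signedCount-shift S d a K =
  trans (cong sumℚ (map-cong (λ (L , e) → trans (cong (_*ℚ (a *ℚ mergeCount L K)) (sgnℚ-+ e d))
          (solve 4 (λ s t a w → (s :* t) :* (a :* w) := (t :* a) :* (s :* w)) refl (sgnℚ e) (sgnℚ d) a (mergeCount L K))) S))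
  (trans (sumℚ-map-*ˡ (sgnℚ d *ℚ a) _ S) (ℚ.*-assoc (sgnℚ d) a _))

matchHead : Block → SSC → (SSC → ℚ) → ℚ
matchHead b []       κ = 0ℚ
matchHead b (x ∷ xs) κ = ⟦ eqB b x ⟧ *ℚ κ xs

crossings : Block → SSC → ℕ
crossings y P = if fermionic y then countFerm P else 0

mergedHead : SSC → SSC → Block → (SSC → SSC → ℚ) → ℚ
mergedHead (x ∷ xs) (y ∷ ys) k κ =
  if not (fermionic x ∧ fermionic y) then sgnℚ (crossings y xs) *ℚ (⟦ eqB k (unionB x y) ⟧ *ℚ κ xs ys) else 0ℚ
mergedHead _        _        k κ = 0ℚ

mergeTerm-false : ∀ b L k K → mergeTerm false b L k K ≡ 0ℚ
mergeTerm-false b []      k K = refl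
mergeTerm-false b (_ ∷ _) k K = refl

mergeTerm-true : ∀ x xs k K → mergeTerm true x (map (true ,_) xs) k K ≡ 0ℚ
mergeTerm-true x []      k K = refl
mergeTerm-true x (_ ∷ _) k K = refl

sgnℚ-crossings-[] : ∀ y → sgnℚ (crossings y []) ≡ 1ℚ
sgnℚ-crossings-[] y with fermionic y
... | true  = refl
... | false = refl

qshCount-[]ʳ : ∀ P K → qshCount P [] K ≡ mergeCount (map (true ,_) P) K
qshCount-[]ʳ []      K = trans (ℚ.+-identityʳ _) (ℚ.*-identityˡ _)
qshCount-[]ʳ (_ ∷ _) K = trans (ℚ.+-identityʳ _) (ℚ.*-identityˡ _)

mergeTerm-sum : ∀ x xs y ys k K →
  sumℚ (map (λ (L , e) → sgnℚ e *ℚ mergeTerm true x L k K) (shuffles xs (y ∷ ys)))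
  ≡ mergedHead (x ∷ xs) (y ∷ ys) k (λ P Q → qshCount P Q K)
mergeTerm-sum x [] y ys k K with not (fermionic x ∧ fermionic y)
... | true  = trans (solve 2 (λ a m → con 1ℚ :* (a :* m) :+ con 0ℚ := con 1ℚ :* (a :* (con 1ℚ :* m :+ con 0ℚ))) refl
                           ⟦ eqB k (unionB x y) ⟧ (mergeCount (map (false ,_) ys) K))
                    (cong (_*ℚ (⟦ eqB k (unionB x y) ⟧ *ℚ qshCount [] ys K)) (sym (sgnℚ-crossings-[] y)))
... | false = refl
mergeTerm-sum x (x′ ∷ xs) y ys k K =
  trans (sumℚ-map-++ f (map (λ (L , e) → (true , x′) ∷ L , e) (shuffles xs (y ∷ ys)))
                       (map (λ (L , e) → (false , y) ∷ L , e + d) (shuffles (x′ ∷ xs) ys)))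
  (trans (cong₂ _+ℚ_ (trans (sumℚ-map-map f _ (shuffles xs (y ∷ ys)))
                            (sumℚ-map-zero (shuffles xs (y ∷ ys)) λ {(L , e)} _ → ℚ.*-zeroʳ (sgnℚ e)))
                     (trans (sumℚ-map-map f _ (shuffles (x′ ∷ xs) ys)) merged))
         (ℚ.+-identityˡ _))
  where
  d = crossings y (x′ ∷ xs)
  f = λ ((L , e) : List TBlock × ℕ) → sgnℚ e *ℚ mergeTerm true x L k K
  merged : sumℚ (map (λ (L , e) → sgnℚ (e + d) *ℚ mergeTerm true x ((false , y) ∷ L) k K) (shuffles (x′ ∷ xs) ys))
           ≡ mergedHead (x ∷ x′ ∷ xs) (y ∷ ys) k (λ P Q → qshCount P Q K)
  merged with not (fermionic x ∧ fermionic y)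
  ... | true  = signedCount-shift (shuffles (x′ ∷ xs) ys) d ⟦ eqB k (unionB x y) ⟧ K
  ... | false = sumℚ-map-zero (shuffles (x′ ∷ xs) ys) λ {(L , e)} _ → ℚ.*-zeroʳ (sgnℚ (e + d))

-- The first block k of a quasi-shuffle comes from P, from Q (passing the fermionic blocks of P),
-- or is the merger of both heads.
headTerms : Block → SSC → SSC → (SSC → SSC → ℚ) → ℚ
headTerms k P Q κ = matchHead k P (λ xs → κ xs Q) +ℚ sgnℚ (crossings k P) *ℚ matchHead k Q (κ P) +ℚ mergedHead P Q k κ

qshCount-∷ : ∀ P Q k K → qshCount P Q (k ∷ K) ≡ headTerms k P Q (λ P′ Q′ → qshCount P′ Q′ K)
qshCount-∷ [] [] k K =
  solve 1 (λ s → con 1ℚ :* (con 0ℚ :+ con 0ℚ) :+ con 0ℚ := con 0ℚ :+ s :* con 0ℚ :+ con 0ℚ) refl (sgnℚ (crossings k []))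
qshCount-∷ [] (y ∷ ys) k K
  rewrite mergeCount-∷ false y (map (false ,_) ys) k K | mergeTerm-false y (map (false ,_) ys) k K =
  trans (solve 2 (λ a m → con 1ℚ :* (a :* m :+ con 0ℚ) :+ con 0ℚ := con 0ℚ :+ con 1ℚ :* (a :* (con 1ℚ :* m :+ con 0ℚ)) :+ con 0ℚ) refl
          ⟦ eqB k y ⟧ (mergeCount (map (false ,_) ys) K))
        (cong (λ s → 0ℚ +ℚ s *ℚ (⟦ eqB k y ⟧ *ℚ qshCount [] ys K) +ℚ 0ℚ) (sym (sgnℚ-crossings-[] k)))
qshCount-∷ (x ∷ xs) [] k K
  rewrite mergeCount-∷ true x (map (true ,_) xs) k K | mergeTerm-true x xs k K | qshCount-[]ʳ xs K =
  solve 3 (λ a m s → con 1ℚ :* (a :* m :+ con 0ℚ) :+ con 0ℚ := a :* m :+ s :* con 0ℚ :+ con 0ℚ) refl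
    ⟦ eqB k x ⟧ (mergeCount (map (true ,_) xs) K) (sgnℚ (crossings k (x ∷ xs)))
qshCount-∷ (x ∷ xs) (y ∷ ys) k K = begin
  qshCount P Q (k ∷ K)
    ≡⟨ sumℚ-map-++ F (map (λ (L , e) → (true , x) ∷ L , e) S₁) (map (λ (L , e) → (false , y) ∷ L , e + d) S₂) ⟩
  sumℚ (map F (map _ S₁)) +ℚ sumℚ (map F (map _ S₂))
    ≡⟨ cong₂ _+ℚ_ x-first y-first ⟩
  (⟦ eqB k x ⟧ *ℚ qshCount xs Q K +ℚ mergedHead P Q k κ) +ℚ sgnℚ d *ℚ (⟦ eqB k y ⟧ *ℚ qshCount P ys K)
    ≡⟨ cong (λ z → (⟦ eqB k x ⟧ *ℚ qshCount xs Q K +ℚ mergedHead P Q k κ) +ℚ z)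
            (solve 3 (λ s a r → s :* (a :* r) := a :* (s :* r)) refl (sgnℚ d) ⟦ eqB k y ⟧ (qshCount P ys K)) ⟩
  (⟦ eqB k x ⟧ *ℚ qshCount xs Q K +ℚ mergedHead P Q k κ) +ℚ ⟦ eqB k y ⟧ *ℚ (sgnℚ d *ℚ qshCount P ys K)
    ≡⟨ cong (λ z → (⟦ eqB k x ⟧ *ℚ qshCount xs Q K +ℚ mergedHead P Q k κ) +ℚ z)
            (⟦eqB⟧-transport k y (λ b → sgnℚ (crossings b P) *ℚ qshCount P ys K)) ⟩
  (⟦ eqB k x ⟧ *ℚ qshCount xs Q K +ℚ mergedHead P Q k κ) +ℚ ⟦ eqB k y ⟧ *ℚ (sgnℚ (crossings k P) *ℚ qshCount P ys K)
    ≡⟨ solve 6 (λ a r m b s r′ → (a :* r :+ m) :+ b :* (s :* r′) := a :* r :+ s :* (b :* r′) :+ m) refl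
               ⟦ eqB k x ⟧ (qshCount xs Q K) (mergedHead P Q k κ) ⟦ eqB k y ⟧ (sgnℚ (crossings k P)) (qshCount P ys K) ⟩
  ⟦ eqB k x ⟧ *ℚ qshCount xs Q K +ℚ sgnℚ (crossings k P) *ℚ (⟦ eqB k y ⟧ *ℚ qshCount P ys K) +ℚ mergedHead P Q k κ ∎
  where
  open ≡-Reasoning
  P = x ∷ xs
  Q = y ∷ ys
  S₁ = shuffles xs Q
  S₂ = shuffles P ys
  d = crossings y P
  κ = λ xs ys → qshCount xs ys K
  F = λ ((L , e) : List TBlock × ℕ) → sgnℚ e *ℚ mergeCount L (k ∷ K)
  x-first : sumℚ (map F (map (λ (L , e) → (true , x) ∷ L , e) S₁)) ≡ ⟦ eqB k x ⟧ *ℚ qshCount xs Q K +ℚ mergedHead P Q k κ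
  x-first = trans (sumℚ-map-map F _ S₁)
    (trans (cong sumℚ (map-cong (λ (L , e) → trans (cong (sgnℚ e *ℚ_) (mergeCount-∷ true x L k K))
              (ℚ.*-distribˡ-+ (sgnℚ e) _ _)) S₁))
    (trans (sumℚ-map-+ _ _ S₁)
      (cong₂ _+ℚ_ (trans (cong sumℚ (map-cong (λ (L , e) →
                            solve 3 (λ s a w → s :* (a :* w) := a :* (s :* w)) refl (sgnℚ e) ⟦ eqB k x ⟧ (mergeCount L K)) S₁))
                         (sumℚ-map-*ˡ ⟦ eqB k x ⟧ _ S₁))
                  (mergeTerm-sum x xs y ys k K))))
  y-first : sumℚ (map F (map (λ (L , e) → (false , y) ∷ L , e + d) S₂)) ≡ sgnℚ d *ℚ (⟦ eqB k y ⟧ *ℚ qshCount P ys K)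
  y-first = trans (sumℚ-map-map F _ S₂)
    (trans (cong sumℚ (map-cong (λ (L , e) → cong (sgnℚ (e + d) *ℚ_)
              (trans (mergeCount-∷ false y L k K)
                     (trans (cong (⟦ eqB k y ⟧ *ℚ mergeCount L K +ℚ_) (mergeTerm-false y L k K)) (ℚ.+-identityʳ _)))) S₂))
    (signedCount-shift S₂ d ⟦ eqB k y ⟧ K))

qshCount-[] : ∀ P Q → qshCount P Q [] ≡ ⟦ eqK P [] ⟧ *ℚ ⟦ eqK Q [] ⟧
qshCount-[] []       []       = refl
qshCount-[] []       (y ∷ ys) = cong (λ z → 1ℚ *ℚ z +ℚ 0ℚ) (mergeCount-[] false y (map (false ,_) ys))
qshCount-[] (x ∷ xs) []       = cong (λ z → 1ℚ *ℚ z +ℚ 0ℚ) (mergeCount-[] true x (map (true ,_) xs))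
qshCount-[] (x ∷ xs) (y ∷ ys) =
  trans (sumℚ-map-++ _ (map (λ (L , e) → (true , x) ∷ L , e) (shuffles xs (y ∷ ys)))
                       (map (λ (L , e) → (false , y) ∷ L , e + crossings y (x ∷ xs)) (shuffles (x ∷ xs) ys)))
  (trans (cong₂ _+ℚ_
    (trans (sumℚ-map-map _ _ (shuffles xs (y ∷ ys))) (sumℚ-map-zero (shuffles xs (y ∷ ys)) λ {(L , e)} _ →
      trans (cong (sgnℚ e *ℚ_) (mergeCount-[] true x L)) (ℚ.*-zeroʳ (sgnℚ e))))
    (trans (sumℚ-map-map _ _ (shuffles (x ∷ xs) ys)) (sumℚ-map-zero (shuffles (x ∷ xs) ys) λ {(L , e)} _ →
      trans (cong (sgnℚ (e + crossings y (x ∷ xs)) *ℚ_) (mergeCount-[] false y L)) (ℚ.*-zeroʳ (sgnℚ (e + crossings y (x ∷ xs)))))))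
  refl)

eqB-mkBlock : ∀ f g {ps qs} → Positive ps → Positive qs → eqB (mkBlock f ps) (mkBlock g qs) ≡ does (f ≟𝔹 g) ∧ eqB ps qs
eqB-mkBlock true  true                    _        _        = refl
eqB-mkBlock false false                   _        _        = refl
eqB-mkBlock true  false {qs = []}         _        _        = refl
eqB-mkBlock true  false {qs = suc _ ∷ _}  _        _        = refl
eqB-mkBlock true  false {qs = zero ∷ _}   _        (() ∷ _)
eqB-mkBlock false true  {[]}              _        _        = refl
eqB-mkBlock false true  {suc _ ∷ _}       _        _        = refl
eqB-mkBlock false true  {zero ∷ _}        (() ∷ _) _

LowPositions : ℕ → List ℕ → Set
LowPositions n = All (λ p → 0 < p × p ≤ n)

HighPositions : ℕ → List ℕ → Set
HighPositions n = All (n <_)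

low⇒positive : ∀ {n ps} → LowPositions n ps → Positive ps
low⇒positive = All.map proj₁

high⇒positive : ∀ {n ps} → HighPositions n ps → Positive ps
high⇒positive = All.map (≤-<-trans z≤n)

++-positive : ∀ {n pl pr} → LowPositions n pl → HighPositions n pr → Positive (pl ++ pr)
++-positive lpl hpr = All-++⁺ (low⇒positive lpl) (high⇒positive hpr)

eqB-++ : ∀ {n a b c d} → LowPositions n a → HighPositions n b → LowPositions n c → HighPositions n d →
         eqB (a ++ b) (c ++ d) ≡ eqB a c ∧ eqB b d
eqB-++ {a = []}     {c = []}                   _ _ _ _ = refl
eqB-++ {a = []}     {b = []}     {c = _ ∷ _}   _ _ _ _ = refl
eqB-++ {a = []}     {b = _ ∷ bs} {c = _ ∷ cs} {d} _ (n<b ∷ _) ((_ , c≤n) ∷ _) _ =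
  cong (_∧ eqB bs (cs ++ d)) (≢⇒≡ᵇ-false λ b≡c → <-irrefl (sym b≡c) (≤-<-trans c≤n n<b))
eqB-++ {a = _ ∷ _}  {c = []}     {d = []}      _ _ _ _ = refl
eqB-++ {a = _ ∷ as} {b} {c = []} {d = _ ∷ ds} ((_ , a≤n) ∷ _) _ _ (n<d ∷ _) =
  cong (_∧ eqB (as ++ b) ds) (≢⇒≡ᵇ-false λ a≡d → <-irrefl a≡d (≤-<-trans a≤n n<d))
eqB-++ {a = a ∷ as} {b} {c ∷ cs} {d} (_ ∷ la) hb (_ ∷ lc) hd =
  trans (cong ((a ≡ᵇ c) ∧_) (eqB-++ la hb lc hd)) (sym (∧-assoc (a ≡ᵇ c) (eqB as cs) (eqB b d)))

data LowBlock (n : ℕ) : Block → Set where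
  lowBlock : ∀ f {ps} → LowPositions n ps → mkBlock f ps ≢ [] → LowBlock n (mkBlock f ps)

data HighBlock (n : ℕ) : Block → Set where
  highBlock : ∀ f {ps} → HighPositions n ps → mkBlock f ps ≢ [] → HighBlock n (mkBlock f ps)

lowBlock-≢[] : ∀ {n b} → LowBlock n b → b ≢ []
lowBlock-≢[] (lowBlock _ _ b≢[]) = b≢[]

highBlock-≢[] : ∀ {n b} → HighBlock n b → b ≢ []
highBlock-≢[] (highBlock _ _ b≢[]) = b≢[]

-- A letter v of w: whether θ_v occurs, and the positions of x_v in the x-word, split into those
-- at most n and those beyond n.
Letter : Set
Letter = Bool × List ℕ × List ℕ

letterBlockOf : Letter → Block
letterBlockOf (f , pl , pr) = mkBlock f (pl ++ pr)

ValidLetter : ℕ → Letter → Set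
ValidLetter n (f , pl , pr) = LowPositions n pl × HighPositions n pr × mkBlock f (pl ++ pr) ≢ []

consume : Block → SSC → (SSC → ℚ) → ℚ
consume []       P κ = κ P
consume (c ∷ cs) P κ = matchHead (c ∷ cs) P κ

-- Signed number of ways to hand the letters to two factors whose set supercompositions are P and Q.
splitCount : List Letter → SSC → SSC → ℚ
splitCount []                      P Q = ⟦ eqK P [] ⟧ *ℚ ⟦ eqK Q [] ⟧
splitCount ((false , pl , pr) ∷ D) P Q = consume pl P λ P′ → consume pr Q (splitCount D P′)
splitCount ((true  , pl , pr) ∷ D) P Q =
  consume (0 ∷ pl) P (λ P′ → consume pr Q (splitCount D P′))
  +ℚ consume pl P (λ P′ → consume (0 ∷ pr) Q λ Q′ → sgnℚ (countFerm P′) *ℚ splitCount D P′ Q′)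

consume-expand : ∀ b {P} → All (_≢ []) P → ∀ κ → consume b P κ ≡ ⟦ eqB b [] ⟧ *ℚ κ P +ℚ matchHead b P κ
consume-expand []       {[]}     _            κ = solve 1 (λ z → z := con 1ℚ :* z :+ con 0ℚ) refl (κ [])
consume-expand []       {x ∷ xs} (x≢[] ∷ _) κ =
  trans (solve 2 (λ z w → z := con 1ℚ :* z :+ con 0ℚ :* w) refl (κ (x ∷ xs)) (κ xs))
        (cong (λ e → 1ℚ *ℚ κ (x ∷ xs) +ℚ ⟦ e ⟧ *ℚ κ xs) (sym (dec-false (≡-dec _≟_ [] x) (x≢[] ∘ sym))))
consume-expand (c ∷ cs) {P}      _            κ = sym (trans (cong (_+ℚ matchHead (c ∷ cs) P κ) (ℚ.*-zeroˡ (κ P))) (ℚ.+-identityˡ _))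

matchHead-cong : ∀ b P {κ ι : SSC → ℚ} → (∀ P′ → κ P′ ≡ ι P′) → matchHead b P κ ≡ matchHead b P ι
matchHead-cong b []       _   = refl
matchHead-cong b (x ∷ xs) κ≗ι = cong (⟦ eqB b x ⟧ *ℚ_) (κ≗ι xs)

matchHead-cong-All : ∀ {R : Block → Set} b {P} {κ ι : SSC → ℚ} → All R P →
                     (∀ {P′} → All R P′ → κ P′ ≡ ι P′) → matchHead b P κ ≡ matchHead b P ι
matchHead-cong-All b {[]}    _        _   = refl
matchHead-cong-All b {x ∷ _} (_ ∷ rs) κ≗ι = cong (⟦ eqB b x ⟧ *ℚ_) (κ≗ι rs)

matchHead-+ : ∀ b P (κ ι : SSC → ℚ) → matchHead b P (λ P′ → κ P′ +ℚ ι P′) ≡ matchHead b P κ +ℚ matchHead b P ι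
matchHead-+ b []       κ ι = refl
matchHead-+ b (x ∷ xs) κ ι = ℚ.*-distribˡ-+ ⟦ eqB b x ⟧ (κ xs) (ι xs)

matchHead-*ˡ : ∀ b P c (κ : SSC → ℚ) → matchHead b P (λ P′ → c *ℚ κ P′) ≡ c *ℚ matchHead b P κ
matchHead-*ˡ b []       c κ = sym (ℚ.*-zeroʳ c)
matchHead-*ˡ b (x ∷ xs) c κ = solve 3 (λ e c z → e :* (c :* z) := c :* (e :* z)) refl ⟦ eqB b x ⟧ c (κ xs)

mergedHead-cong-All : ∀ {R S : Block → Set} k {P Q} {κ ι : SSC → SSC → ℚ} → All R P → All S Q →
                      (∀ {P′ Q′} → All R P′ → All S Q′ → κ P′ Q′ ≡ ι P′ Q′) → mergedHead P Q k κ ≡ mergedHead P Q k ι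
mergedHead-cong-All k []                _         _   = refl
mergedHead-cong-All k (_ ∷ _)           []        _   = refl
mergedHead-cong-All k {x ∷ xs} {y ∷ ys} (_ ∷ rs) (_ ∷ ss) κ≗ι =
  cong (λ z → if not (fermionic x ∧ fermionic y) then sgnℚ (crossings y xs) *ℚ (⟦ eqB k (unionB x y) ⟧ *ℚ z) else 0ℚ) (κ≗ι rs ss)

headTerms-cong : ∀ {n} k {P Q} {κ ι : SSC → SSC → ℚ} → All (LowBlock n) P → All (HighBlock n) Q →
                 (∀ {P′ Q′} → All (LowBlock n) P′ → All (HighBlock n) Q′ → κ P′ Q′ ≡ ι P′ Q′) →
                 headTerms k P Q κ ≡ headTerms k P Q ι
headTerms-cong k {P} lowP highQ κ≗ι =
  cong₂ _+ℚ_ (cong₂ (λ u v → u +ℚ sgnℚ (crossings k P) *ℚ v)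
                    (matchHead-cong-All k lowP (λ lowP′ → κ≗ι lowP′ highQ))
                    (matchHead-cong-All k highQ (κ≗ι lowP)))
             (mergedHead-cong-All k lowP highQ κ≗ι)

matchHead-low : ∀ {n} f {pl pr P} → LowPositions n pl → HighPositions n pr → All (LowBlock n) P → ∀ κ →
                ⟦ eqB pr [] ⟧ *ℚ matchHead (mkBlock f pl) P κ ≡ matchHead (mkBlock f (pl ++ pr)) P κ
matchHead-low f {pr = pr}            lpl hpr []                               κ = ℚ.*-zeroʳ ⟦ eqB pr [] ⟧
matchHead-low f {pl} {pr} {_ ∷ xs} lpl hpr (lowBlock fx {px} lpx _ ∷ _)  κ = begin
  ⟦ eqB pr [] ⟧ *ℚ (⟦ eqB (mkBlock f pl) x ⟧ *ℚ κ xs)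
    ≡⟨ cong (λ e → ⟦ eqB pr [] ⟧ *ℚ (⟦ e ⟧ *ℚ κ xs)) (eqB-mkBlock f fx (low⇒positive lpl) (low⇒positive lpx)) ⟩
  ⟦ eqB pr [] ⟧ *ℚ (⟦ does (f ≟𝔹 fx) ∧ eqB pl px ⟧ *ℚ κ xs)
    ≡⟨ ⟦∧⟧-rotate (does (f ≟𝔹 fx)) (eqB pl px) (eqB pr []) (κ xs) ⟩
  ⟦ does (f ≟𝔹 fx) ∧ (eqB pl px ∧ eqB pr []) ⟧ *ℚ κ xs
    ≡⟨ cong (λ e → ⟦ does (f ≟𝔹 fx) ∧ e ⟧ *ℚ κ xs) (trans (cong (eqB (pl ++ pr)) (sym (++-identityʳ px))) (eqB-++ lpl hpr lpx [])) ⟨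
  ⟦ does (f ≟𝔹 fx) ∧ eqB (pl ++ pr) px ⟧ *ℚ κ xs
    ≡⟨ cong (λ e → ⟦ e ⟧ *ℚ κ xs) (eqB-mkBlock f fx (++-positive lpl hpr) (low⇒positive lpx)) ⟨
  ⟦ eqB (mkBlock f (pl ++ pr)) x ⟧ *ℚ κ xs ∎
  where
  open ≡-Reasoning
  x = mkBlock fx px

matchHead-high : ∀ {n} f {pl pr Q} → LowPositions n pl → HighPositions n pr → All (HighBlock n) Q → ∀ κ →
                 ⟦ eqB pl [] ⟧ *ℚ matchHead (mkBlock f pr) Q κ ≡ matchHead (mkBlock f (pl ++ pr)) Q κ
matchHead-high f {pl}                lpl hpr []                                 κ = ℚ.*-zeroʳ ⟦ eqB pl [] ⟧
matchHead-high f {pl} {pr} {_ ∷ ys} lpl hpr (highBlock fy {py} hpy _ ∷ _)  κ = begin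
  ⟦ eqB pl [] ⟧ *ℚ (⟦ eqB (mkBlock f pr) y ⟧ *ℚ κ ys)
    ≡⟨ cong (λ e → ⟦ eqB pl [] ⟧ *ℚ (⟦ e ⟧ *ℚ κ ys)) (eqB-mkBlock f fy (high⇒positive hpr) (high⇒positive hpy)) ⟩
  ⟦ eqB pl [] ⟧ *ℚ (⟦ does (f ≟𝔹 fy) ∧ eqB pr py ⟧ *ℚ κ ys)
    ≡⟨ ⟦∧⟧-swap (eqB pl []) (does (f ≟𝔹 fy)) (eqB pr py) (κ ys) ⟩
  ⟦ does (f ≟𝔹 fy) ∧ (eqB pl [] ∧ eqB pr py) ⟧ *ℚ κ ys
    ≡⟨ cong (λ e → ⟦ does (f ≟𝔹 fy) ∧ e ⟧ *ℚ κ ys) (eqB-++ lpl hpr [] hpy) ⟨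
  ⟦ does (f ≟𝔹 fy) ∧ eqB (pl ++ pr) py ⟧ *ℚ κ ys
    ≡⟨ cong (λ e → ⟦ e ⟧ *ℚ κ ys) (eqB-mkBlock f fy (++-positive lpl hpr) (high⇒positive hpy)) ⟨
  ⟦ eqB (mkBlock f (pl ++ pr)) y ⟧ *ℚ κ ys ∎
  where
  open ≡-Reasoning
  y = mkBlock fy py

mergedHead-mkBlock : ∀ {n} f {pl pr} fx {px} fy {py} xs ys κ →
  LowPositions n pl → HighPositions n pr → LowPositions n px → HighPositions n py →
  mergedHead (mkBlock fx px ∷ xs) (mkBlock fy py ∷ ys) (mkBlock f (pl ++ pr)) κ
  ≡ (if not (fx ∧ fy)
     then sgnℚ (if fy then countFerm xs else 0) *ℚ (⟦ does (f ≟𝔹 (fx ∨ fy)) ∧ (eqB pl px ∧ eqB pr py) ⟧ *ℚ κ xs ys)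
     else 0ℚ)
mergedHead-mkBlock f fx fy xs ys κ lpl hpr lpx hpy
  rewrite unionB-mkBlock fx fy (low⇒positive lpx) (high⇒positive hpy)
        | fermionic-mkBlock fx (low⇒positive lpx) | fermionic-mkBlock fy (high⇒positive hpy)
        | eqB-mkBlock f (fx ∨ fy) (++-positive lpl hpr) (++-positive lpx hpy)
        | eqB-++ lpl hpr lpx hpy = refl

mergeIndicator-boson : ∀ fx fy a b c z →
  ⟦ does (false ≟𝔹 fx) ∧ a ⟧ *ℚ (⟦ does (false ≟𝔹 fy) ∧ b ⟧ *ℚ z)
  ≡ (if not (fx ∧ fy) then sgnℚ (if fy then c else 0) *ℚ (⟦ does (false ≟𝔹 (fx ∨ fy)) ∧ (a ∧ b) ⟧ *ℚ z) else 0ℚ)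
mergeIndicator-boson false false a b c z rewrite ⟦∧⟧ a b =
  solve 3 (λ a b z → a :* (b :* z) := con 1ℚ :* (a :* b :* z)) refl ⟦ a ⟧ ⟦ b ⟧ z
mergeIndicator-boson false true  a b c z = solve 3 (λ a s z → a :* (con 0ℚ :* z) := s :* (con 0ℚ :* z)) refl ⟦ a ⟧ (sgnℚ c) z
mergeIndicator-boson true  false a b c z = solve 2 (λ b z → con 0ℚ :* (b :* z) := con 1ℚ :* (con 0ℚ :* z)) refl ⟦ b ⟧ z
mergeIndicator-boson true  true  a b c z = solve 1 (λ z → con 0ℚ :* (con 0ℚ :* z) := con 0ℚ) refl z

mergeIndicator-fermion : ∀ fx fy a b c z →
  ⟦ does (true ≟𝔹 fx) ∧ a ⟧ *ℚ (⟦ does (false ≟𝔹 fy) ∧ b ⟧ *ℚ z)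
  +ℚ ⟦ does (false ≟𝔹 fx) ∧ a ⟧ *ℚ (⟦ does (true ≟𝔹 fy) ∧ b ⟧ *ℚ (sgnℚ c *ℚ z))
  ≡ (if not (fx ∧ fy) then sgnℚ (if fy then c else 0) *ℚ (⟦ does (true ≟𝔹 (fx ∨ fy)) ∧ (a ∧ b) ⟧ *ℚ z) else 0ℚ)
mergeIndicator-fermion true  false a b c z rewrite ⟦∧⟧ a b =
  solve 4 (λ a b s z → a :* (b :* z) :+ con 0ℚ :* (con 0ℚ :* (s :* z)) := con 1ℚ :* (a :* b :* z)) refl ⟦ a ⟧ ⟦ b ⟧ (sgnℚ c) z
mergeIndicator-fermion false true  a b c z rewrite ⟦∧⟧ a b =
  solve 4 (λ a b s z → con 0ℚ :* (con 0ℚ :* z) :+ a :* (b :* (s :* z)) := s :* (a :* b :* z)) refl ⟦ a ⟧ ⟦ b ⟧ (sgnℚ c) z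
mergeIndicator-fermion false false a b c z =
  solve 4 (λ a b s z → con 0ℚ :* (b :* z) :+ a :* (con 0ℚ :* (s :* z)) := con 1ℚ :* (con 0ℚ :* z)) refl ⟦ a ⟧ ⟦ b ⟧ (sgnℚ c) z
mergeIndicator-fermion true  true  a b c z =
  solve 4 (λ a b s z → a :* (con 0ℚ :* z) :+ con 0ℚ :* (b :* (s :* z)) := con 0ℚ) refl ⟦ a ⟧ ⟦ b ⟧ (sgnℚ c) z

matchHead-matchHead-boson : ∀ {n pl pr P Q} → LowPositions n pl → HighPositions n pr → All (LowBlock n) P → All (HighBlock n) Q → ∀ κ →
  matchHead pl P (λ P′ → matchHead pr Q (κ P′)) ≡ mergedHead P Q (mkBlock false (pl ++ pr)) κ
matchHead-matchHead-boson {pl = pl} _ _ [] _ κ = refl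
matchHead-matchHead-boson {pl = pl} {P = x ∷ _} _ _ (_ ∷ _) [] κ = ℚ.*-zeroʳ ⟦ eqB pl x ⟧
matchHead-matchHead-boson {pl = pl} {pr} {_ ∷ xs} {_ ∷ ys} lpl hpr (lowBlock fx {px} lpx _ ∷ _) (highBlock fy {py} hpy _ ∷ _) κ =
  trans (cong₂ (λ a b → ⟦ a ⟧ *ℚ (⟦ b ⟧ *ℚ κ xs ys))
               (eqB-mkBlock false fx (low⇒positive lpl) (low⇒positive lpx)) (eqB-mkBlock false fy (high⇒positive hpr) (high⇒positive hpy)))
  (trans (mergeIndicator-boson fx fy (eqB pl px) (eqB pr py) (countFerm xs) (κ xs ys))
         (sym (mergedHead-mkBlock false fx fy xs ys κ lpl hpr lpx hpy)))

matchHead-matchHead-fermion : ∀ {n pl pr P Q} → LowPositions n pl → HighPositions n pr → All (LowBlock n) P → All (HighBlock n) Q → ∀ κ →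
  matchHead (0 ∷ pl) P (λ P′ → matchHead pr Q (κ P′))
  +ℚ matchHead pl P (λ P′ → matchHead (0 ∷ pr) Q (λ Q′ → sgnℚ (countFerm P′) *ℚ κ P′ Q′))
  ≡ mergedHead P Q (mkBlock true (pl ++ pr)) κ
matchHead-matchHead-fermion _ _ [] _ κ = refl
matchHead-matchHead-fermion {pl = pl} {pr} {x ∷ _} _ _ (_ ∷ _) [] κ =
  trans (cong₂ _+ℚ_ (ℚ.*-zeroʳ ⟦ eqB (0 ∷ pl) x ⟧) (ℚ.*-zeroʳ ⟦ eqB pl x ⟧)) (ℚ.+-identityˡ 0ℚ)
matchHead-matchHead-fermion {pl = pl} {pr} {_ ∷ xs} {_ ∷ ys} lpl hpr (lowBlock fx {px} lpx _ ∷ _) (highBlock fy {py} hpy _ ∷ _) κ =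
  trans (cong₂ (λ (a , b) (a′ , b′) →
                 ⟦ a ⟧ *ℚ (⟦ b ⟧ *ℚ κ xs ys) +ℚ ⟦ a′ ⟧ *ℚ (⟦ b′ ⟧ *ℚ (sgnℚ (countFerm xs) *ℚ κ xs ys)))
               (cong₂ _,_ (eqB-mkBlock true fx (low⇒positive lpl) (low⇒positive lpx)) (eqB-mkBlock false fy (high⇒positive hpr) (high⇒positive hpy)))
               (cong₂ _,_ (eqB-mkBlock false fx (low⇒positive lpl) (low⇒positive lpx)) (eqB-mkBlock true fy (high⇒positive hpr) (high⇒positive hpy))))
  (trans (mergeIndicator-fermion fx fy (eqB pl px) (eqB pr py) (countFerm xs) (κ xs ys))
         (sym (mergedHead-mkBlock true fx fy xs ys κ lpl hpr lpx hpy)))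

sgnℚ-crossings-boson : ∀ {ps} → Positive ps → ∀ P → sgnℚ (crossings (mkBlock false ps) P) ≡ 1ℚ
sgnℚ-crossings-boson pos P rewrite fermionic-mkBlock false pos = refl

⟦eqB[]⟧-*-≡0 : ∀ pl pr → pl ++ pr ≢ [] → ⟦ eqB pl [] ⟧ *ℚ ⟦ eqB pr [] ⟧ ≡ 0ℚ
⟦eqB[]⟧-*-≡0 []      []      ne = ⊥-elim (ne refl)
⟦eqB[]⟧-*-≡0 []      (_ ∷ _) _  = refl
⟦eqB[]⟧-*-≡0 (_ ∷ _) pr      _  = ℚ.*-zeroˡ ⟦ eqB pr [] ⟧

splitStep-boson : ∀ {n pl pr P Q} → ValidLetter n (false , pl , pr) → All (LowBlock n) P → All (HighBlock n) Q → ∀ L →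
                  consume pl P (λ P′ → consume pr Q (L P′)) ≡ headTerms (mkBlock false (pl ++ pr)) P Q L
splitStep-boson {pl = pl} {pr} {P} {Q} (lpl , hpr , nonEmpty) lowP highQ L = begin
  consume pl P (λ P′ → consume pr Q (L P′))
    ≡⟨ consume-expand pl (All.map lowBlock-≢[] lowP) _ ⟩
  e₁ *ℚ consume pr Q (L P) +ℚ matchHead pl P (λ P′ → consume pr Q (L P′))
    ≡⟨ cong₂ (λ u v → e₁ *ℚ u +ℚ v) (consume-expand pr Q≢[] (L P)) (matchHead-cong pl P (λ P′ → consume-expand pr Q≢[] (L P′))) ⟩
  e₁ *ℚ (e₂ *ℚ L P Q +ℚ Y) +ℚ matchHead pl P (λ P′ → e₂ *ℚ L P′ Q +ℚ matchHead pr Q (L P′))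
    ≡⟨ cong (e₁ *ℚ (e₂ *ℚ L P Q +ℚ Y) +ℚ_) (trans (matchHead-+ pl P _ _) (cong (_+ℚ XY) (matchHead-*ˡ pl P e₂ (λ P′ → L P′ Q)))) ⟩
  e₁ *ℚ (e₂ *ℚ L P Q +ℚ Y) +ℚ (e₂ *ℚ X +ℚ XY)
    ≡⟨ solve 6 (λ e₁ e₂ z y x w → e₁ :* (e₂ :* z :+ y) :+ (e₂ :* x :+ w) := (e₁ :* e₂) :* z :+ (e₂ :* x :+ e₁ :* y :+ w)) refl
               e₁ e₂ (L P Q) Y X XY ⟩
  (e₁ *ℚ e₂) *ℚ L P Q +ℚ (e₂ *ℚ X +ℚ e₁ *ℚ Y +ℚ XY)
    ≡⟨ cong (λ z → z *ℚ L P Q +ℚ (e₂ *ℚ X +ℚ e₁ *ℚ Y +ℚ XY)) (⟦eqB[]⟧-*-≡0 pl pr nonEmpty) ⟩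
  0ℚ *ℚ L P Q +ℚ (e₂ *ℚ X +ℚ e₁ *ℚ Y +ℚ XY)
    ≡⟨ trans (cong (_+ℚ (e₂ *ℚ X +ℚ e₁ *ℚ Y +ℚ XY)) (ℚ.*-zeroˡ (L P Q))) (ℚ.+-identityˡ _) ⟩
  e₂ *ℚ X +ℚ e₁ *ℚ Y +ℚ XY
    ≡⟨ cong₂ (λ u v → u +ℚ v +ℚ XY) (matchHead-low false lpl hpr lowP _)
             (trans (matchHead-high false lpl hpr highQ (L P))
                    (trans (sym (ℚ.*-identityˡ _)) (cong (_*ℚ matchHead kd Q (L P)) (sym (sgnℚ-crossings-boson (++-positive lpl hpr) P))))) ⟩
  matchHead kd P (λ P′ → L P′ Q) +ℚ sgnℚ (crossings kd P) *ℚ matchHead kd Q (L P) +ℚ XY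
    ≡⟨ cong (matchHead kd P (λ P′ → L P′ Q) +ℚ sgnℚ (crossings kd P) *ℚ matchHead kd Q (L P) +ℚ_)
            (matchHead-matchHead-boson lpl hpr lowP highQ L) ⟩
  headTerms kd P Q L ∎
  where
  open ≡-Reasoning
  kd = mkBlock false (pl ++ pr)
  Q≢[] = All.map highBlock-≢[] highQ
  e₁ = ⟦ eqB pl [] ⟧
  e₂ = ⟦ eqB pr [] ⟧
  X = matchHead pl P (λ P′ → L P′ Q)
  Y = matchHead pr Q (L P)
  XY = matchHead pl P (λ P′ → matchHead pr Q (L P′))

splitStep-fermion : ∀ {n pl pr P Q} → ValidLetter n (true , pl , pr) → All (LowBlock n) P → All (HighBlock n) Q → ∀ L →
  consume (0 ∷ pl) P (λ P′ → consume pr Q (L P′))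
  +ℚ consume pl P (λ P′ → consume (0 ∷ pr) Q λ Q′ → sgnℚ (countFerm P′) *ℚ L P′ Q′)
  ≡ headTerms (mkBlock true (pl ++ pr)) P Q L
splitStep-fermion {pl = pl} {pr} {P} {Q} (lpl , hpr , _) lowP highQ L = begin
  matchHead (0 ∷ pl) P (λ P′ → consume pr Q (L P′))
  +ℚ consume pl P (λ P′ → matchHead (0 ∷ pr) Q λ Q′ → sgnℚ (countFerm P′) *ℚ L P′ Q′)
    ≡⟨ cong₂ _+ℚ_ left right ⟩
  (e₂ *ℚ X +ℚ XY₁) +ℚ (e₁ *ℚ (s *ℚ Y) +ℚ XY₂)
    ≡⟨ solve 7 (λ e₁ e₂ s x y a b → (e₂ :* x :+ a) :+ (e₁ :* (s :* y) :+ b) := e₂ :* x :+ s :* (e₁ :* y) :+ (a :+ b)) refl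
               e₁ e₂ s X Y XY₁ XY₂ ⟩
  e₂ *ℚ X +ℚ s *ℚ (e₁ *ℚ Y) +ℚ (XY₁ +ℚ XY₂)
    ≡⟨ cong₂ (λ u v → u +ℚ s *ℚ v +ℚ (XY₁ +ℚ XY₂)) (matchHead-low true lpl hpr lowP _) (matchHead-high true lpl hpr highQ (L P)) ⟩
  matchHead kd P (λ P′ → L P′ Q) +ℚ s *ℚ matchHead kd Q (L P) +ℚ (XY₁ +ℚ XY₂)
    ≡⟨ cong (matchHead kd P (λ P′ → L P′ Q) +ℚ s *ℚ matchHead kd Q (L P) +ℚ_) (matchHead-matchHead-fermion lpl hpr lowP highQ L) ⟩
  headTerms kd P Q L ∎
  where
  open ≡-Reasoning
  kd = mkBlock true (pl ++ pr)
  e₁ = ⟦ eqB pl [] ⟧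
  e₂ = ⟦ eqB pr [] ⟧
  s = sgnℚ (countFerm P)
  X = matchHead (0 ∷ pl) P (λ P′ → L P′ Q)
  Y = matchHead (0 ∷ pr) Q (L P)
  XY₁ = matchHead (0 ∷ pl) P (λ P′ → matchHead pr Q (L P′))
  XY₂ = matchHead pl P (λ P′ → matchHead (0 ∷ pr) Q (λ Q′ → sgnℚ (countFerm P′) *ℚ L P′ Q′))
  left : matchHead (0 ∷ pl) P (λ P′ → consume pr Q (L P′)) ≡ e₂ *ℚ X +ℚ XY₁
  left = trans (matchHead-cong (0 ∷ pl) P (λ P′ → consume-expand pr (All.map highBlock-≢[] highQ) (L P′)))
               (trans (matchHead-+ (0 ∷ pl) P _ _) (cong (_+ℚ XY₁) (matchHead-*ˡ (0 ∷ pl) P e₂ (λ P′ → L P′ Q))))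
  right : consume pl P (λ P′ → matchHead (0 ∷ pr) Q λ Q′ → sgnℚ (countFerm P′) *ℚ L P′ Q′) ≡ e₁ *ℚ (s *ℚ Y) +ℚ XY₂
  right = trans (consume-expand pl (All.map lowBlock-≢[] lowP) _)
                (cong (λ z → e₁ *ℚ z +ℚ XY₂) (matchHead-*ˡ (0 ∷ pr) Q s (L P)))

splitCount-qshCount : ∀ {n} D {P Q} → All (ValidLetter n) D → All (LowBlock n) P → All (HighBlock n) Q →
                      splitCount D P Q ≡ qshCount P Q (map letterBlockOf D)
splitCount-qshCount []                {P} {Q} _        _    _     = sym (qshCount-[] P Q)
splitCount-qshCount ((f , pl , pr) ∷ D) {P} {Q} (v ∷ vs) lowP highQ = begin
  splitCount ((f , pl , pr) ∷ D) P Q            ≡⟨ step f v ⟩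
  headTerms kd P Q (splitCount D)              ≡⟨ headTerms-cong kd lowP highQ (splitCount-qshCount D vs) ⟩
  headTerms kd P Q (λ P′ Q′ → qshCount P′ Q′ K) ≡⟨ qshCount-∷ P Q kd K ⟨
  qshCount P Q (kd ∷ K)                         ∎
  where
  open ≡-Reasoning
  kd = mkBlock f (pl ++ pr)
  K = map letterBlockOf D
  step : ∀ f → ValidLetter _ (f , pl , pr) →
         splitCount ((f , pl , pr) ∷ D) P Q ≡ headTerms (mkBlock f (pl ++ pr)) P Q (splitCount D)
  step false v = splitStep-boson v lowP highQ (splitCount D)
  step true  v = splitStep-fermion v lowP highQ (splitCount D)

-- The product of M_I and M_J, letter by letter

⟦eqK⟧-filter-∷ : ∀ b X P → ⟦ eqK (filterᵇ nonEmpty (b ∷ X)) P ⟧ ≡ consume b P (λ P′ → ⟦ eqK (filterᵇ nonEmpty X) P′ ⟧)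
⟦eqK⟧-filter-∷ []       X P        = refl
⟦eqK⟧-filter-∷ (c ∷ cs) X []       = refl
⟦eqK⟧-filter-∷ (c ∷ cs) X (x ∷ xs) = ⟦∧⟧ (eqB (c ∷ cs) x) (eqK (filterᵇ nonEmpty X) xs)

consume-cong : ∀ b P {κ ι : SSC → ℚ} → (∀ P′ → κ P′ ≡ ι P′) → consume b P κ ≡ consume b P ι
consume-cong []       P κ≗ι = κ≗ι P
consume-cong (c ∷ cs) P κ≗ι = matchHead-cong (c ∷ cs) P κ≗ι

consume-*ˡ : ∀ b P c (κ : SSC → ℚ) → consume b P (λ P′ → c *ℚ κ P′) ≡ c *ℚ consume b P κ
consume-*ˡ []       P c κ = refl
consume-*ˡ (d ∷ ds) P c κ = matchHead-*ˡ (d ∷ ds) P c κ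

consume-* : ∀ b P κ b′ Q ι → consume b P κ *ℚ consume b′ Q ι ≡ consume b P (λ P′ → consume b′ Q (λ Q′ → κ P′ *ℚ ι Q′))
consume-* b P κ b′ Q ι = begin
  consume b P κ *ℚ consume b′ Q ι             ≡⟨ ℚ.*-comm (consume b P κ) _ ⟩
  consume b′ Q ι *ℚ consume b P κ             ≡⟨ consume-*ˡ b P (consume b′ Q ι) κ ⟨
  consume b P (λ P′ → consume b′ Q ι *ℚ κ P′)
    ≡⟨ consume-cong b P (λ P′ → trans (ℚ.*-comm _ (κ P′)) (sym (consume-*ˡ b′ Q (κ P′) ι))) ⟩
  consume b P (λ P′ → consume b′ Q (λ Q′ → κ P′ *ℚ ι Q′)) ∎
  where open ≡-Reasoning

consume-sumℚ : ∀ {A : Set} b P (l : List A) (h : A → SSC → ℚ) →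
               sumℚ (map (λ t → consume b P (h t)) l) ≡ consume b P (λ P′ → sumℚ (map (λ t → h t P′) l))
consume-sumℚ []       P        l h = refl
consume-sumℚ (c ∷ cs) []       l h = sumℚ-map-zero l (λ _ → refl)
consume-sumℚ (c ∷ cs) (x ∷ xs) l h = sumℚ-map-*ˡ ⟦ eqB (c ∷ cs) x ⟧ (λ t → h t xs) l

countFerm-map : ∀ {A : Set} (g : A → Block) S → countFerm (map g S) ≡ length (filterᵇ (λ v → fermionic (g v)) S)
countFerm-map g []      = refl
countFerm-map g (v ∷ S) with fermionic (g v)
... | true  = cong suc (countFerm-map g S)
... | false = countFerm-map g S

countFerm-filterᵇ-nonEmpty : ∀ L → countFerm (filterᵇ nonEmpty L) ≡ countFerm L
countFerm-filterᵇ-nonEmpty []             = refl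
countFerm-filterᵇ-nonEmpty ([] ∷ L)       = countFerm-filterᵇ-nonEmpty L
countFerm-filterᵇ-nonEmpty ((c ∷ cs) ∷ L) with fermionic (c ∷ cs)
... | true  = cong suc (countFerm-filterᵇ-nonEmpty L)
... | false = countFerm-filterᵇ-nonEmpty L

countFerm-blocksOf : ∀ pos {A S} → (∀ v → Positive (pos v)) → Sorted S → Sorted A → A ⊆ S → countFerm (blocksOf pos A S) ≡ length A
countFerm-blocksOf pos {A} {S} pos⁺ sS sA A⊆S = begin
  countFerm (blocksOf pos A S)                                       ≡⟨ countFerm-filterᵇ-nonEmpty (map (λ v → mkBlock (memb v A) (pos v)) S) ⟩
  countFerm (map (λ v → mkBlock (memb v A) (pos v)) S)               ≡⟨ countFerm-map _ S ⟩
  length (filterᵇ (λ v → fermionic (mkBlock (memb v A) (pos v))) S)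
    ≡⟨ cong length (filterᵇ-cong (λ v → fermionic-mkBlock (memb v A) (pos⁺ v)) S) ⟩
  length (filterᵇ (λ v → memb v A) S)                                ≡⟨ cong length (filterᵇ-memb sS sA A⊆S) ⟩
  length A                                                           ∎
  where open ≡-Reasoning

⟦eqK[]⟧-sym : ∀ P → ⟦ eqK [] P ⟧ ≡ ⟦ eqK P [] ⟧
⟦eqK[]⟧-sym []      = refl
⟦eqK[]⟧-sym (_ ∷ _) = refl

memb-∷-∉ : ∀ {v} A {S} → v ∉ S → ∀ {w} → w ∈ S → memb w (v ∷ A) ≡ memb w A
memb-∷-∉ {v} A v∉S {w} w∈S = cong (_∨ memb w A) (≢⇒≡ᵇ-false {w} {v} λ { refl → v∉S w∈S })

blocksOf-∷-∉ : ∀ pos {v} A {S} → v ∉ S → blocksOf pos (v ∷ A) S ≡ blocksOf pos A S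
blocksOf-∷-∉ pos A {S} v∉S = cong (filterᵇ nonEmpty) (map-cong-∈ S λ w∈S → cong (λ f → mkBlock f _) (memb-∷-∉ A v∉S w∈S))

letterData : (ℕ → Bool) → (ℕ → List ℕ) → (ℕ → List ℕ) → ℕ → Letter
letterData θ pl pr v = θ v , pl v , pr v

signedPairCount : (ℕ → List ℕ) → (ℕ → List ℕ) → List ℕ → θSplit → SSC → SSC → ℚ
signedPairCount pl pr S (A , B , c) P Q = sgnℚ c *ℚ (⟦ eqK (blocksOf pl A S) P ⟧ *ℚ ⟦ eqK (blocksOf pr B S) Q ⟧)

splitSum : (ℕ → Bool) → (ℕ → List ℕ) → (ℕ → List ℕ) → List ℕ → SSC → SSC → ℚ
splitSum θ pl pr S P Q = sumℚ (map (λ t → signedPairCount pl pr S t P Q) (splitsθ (filterᵇ θ S)))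

signedPairCount-∷ : ∀ pl pr v S A B c P Q → signedPairCount pl pr (v ∷ S) (A , B , c) P Q
  ≡ consume (mkBlock (memb v A) (pl v)) P (λ P′ → consume (mkBlock (memb v B) (pr v)) Q (λ Q′ → signedPairCount pl pr S (A , B , c) P′ Q′))
signedPairCount-∷ pl pr v S A B c P Q = begin
  sgnℚ c *ℚ (⟦ eqK (blocksOf pl A (v ∷ S)) P ⟧ *ℚ ⟦ eqK (blocksOf pr B (v ∷ S)) Q ⟧)
    ≡⟨ cong₂ (λ x y → sgnℚ c *ℚ (x *ℚ y)) (⟦eqK⟧-filter-∷ bl _ P) (⟦eqK⟧-filter-∷ br _ Q) ⟩
  sgnℚ c *ℚ (consume bl P κ *ℚ consume br Q ι)
    ≡⟨ cong (sgnℚ c *ℚ_) (consume-* bl P κ br Q ι) ⟩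
  sgnℚ c *ℚ consume bl P (λ P′ → consume br Q (λ Q′ → κ P′ *ℚ ι Q′))
    ≡⟨ consume-*ˡ bl P (sgnℚ c) _ ⟨
  consume bl P (λ P′ → sgnℚ c *ℚ consume br Q (λ Q′ → κ P′ *ℚ ι Q′))
    ≡⟨ consume-cong bl P (λ P′ → sym (consume-*ˡ br Q (sgnℚ c) _)) ⟩
  consume bl P (λ P′ → consume br Q (λ Q′ → sgnℚ c *ℚ (κ P′ *ℚ ι Q′))) ∎
  where
  open ≡-Reasoning
  bl = mkBlock (memb v A) (pl v)
  br = mkBlock (memb v B) (pr v)
  κ = λ P′ → ⟦ eqK (blocksOf pl A S) P′ ⟧
  ι = λ Q′ → ⟦ eqK (blocksOf pr B S) Q′ ⟧

-- Moving θ_v to the right factor passes it across the fermions of the left factor, whose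
-- count is recovered from P′ whenever the indicator is nonzero.
sgnℚ-transfer : ∀ c m X P′ r → countFerm X ≡ m →
  sgnℚ (c + m) *ℚ (⟦ eqK X P′ ⟧ *ℚ r) ≡ sgnℚ (countFerm P′) *ℚ (sgnℚ c *ℚ (⟦ eqK X P′ ⟧ *ℚ r))
sgnℚ-transfer c m X P′ r cF≡ with eqK X P′ | eqK-reflects X P′
... | false | _        = solve 4 (λ a b d r → a :* (con 0ℚ :* r) := b :* (d :* (con 0ℚ :* r))) refl
                           (sgnℚ (c + m)) (sgnℚ (countFerm P′)) (sgnℚ c) r
... | true  | ofʸ refl rewrite cF≡ | sgnℚ-+ c m =
  solve 3 (λ a b r → (a :* b) :* (con 1ℚ :* r) := b :* (a :* (con 1ℚ :* r))) refl (sgnℚ c) (sgnℚ m) r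

memb-here : ∀ v A → memb v (v ∷ A) ≡ true
memb-here v A = cong (_∨ memb v A) (≡ᵇ-refl v)

signedPairCount-∷-absent : ∀ pl pr {v S A B} c P Q → v ∉ A → v ∉ B →
  signedPairCount pl pr (v ∷ S) (A , B , c) P Q
  ≡ consume (pl v) P (λ P′ → consume (pr v) Q (signedPairCount pl pr S (A , B , c) P′))
signedPairCount-∷-absent pl pr {v} {S} {A} {B} c P Q v∉A v∉B =
  trans (signedPairCount-∷ pl pr v S A B c P Q)
        (cong₂ (λ e g → consume (mkBlock e (pl v)) P (λ P′ → consume (mkBlock g (pr v)) Q (signedPairCount pl pr S (A , B , c) P′)))
               (∉⇒memb v∉A) (∉⇒memb v∉B))

signedPairCount-∷-left : ∀ pl pr {v S} A {B} c P Q → v ∉ S → v ∉ B →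
  signedPairCount pl pr (v ∷ S) (v ∷ A , B , c) P Q
  ≡ consume (0 ∷ pl v) P (λ P′ → consume (pr v) Q (signedPairCount pl pr S (A , B , c) P′))
signedPairCount-∷-left pl pr {v} {S} A {B} c P Q v∉S v∉B =
  trans (signedPairCount-∷ pl pr v S (v ∷ A) B c P Q)
  (trans (cong₂ (λ e g → consume (mkBlock e (pl v)) P (λ P′ → consume (mkBlock g (pr v)) Q (signedPairCount pl pr S (v ∷ A , B , c) P′)))
                (memb-here v A) (∉⇒memb v∉B))
         (consume-cong (0 ∷ pl v) P λ P′ → consume-cong (pr v) Q λ Q′ →
           cong (λ X → sgnℚ c *ℚ (⟦ eqK X P′ ⟧ *ℚ ⟦ eqK (blocksOf pr B S) Q′ ⟧)) (blocksOf-∷-∉ pl A v∉S)))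

signedPairCount-∷-right : ∀ pl pr {v S A} B c P Q → v ∉ S → v ∉ A → countFerm (blocksOf pl A S) ≡ length A →
  signedPairCount pl pr (v ∷ S) (A , v ∷ B , c + length A) P Q
  ≡ consume (pl v) P (λ P′ → consume (0 ∷ pr v) Q (λ Q′ → sgnℚ (countFerm P′) *ℚ signedPairCount pl pr S (A , B , c) P′ Q′))
signedPairCount-∷-right pl pr {v} {S} {A} B c P Q v∉S v∉A countFerm≡ =
  trans (signedPairCount-∷ pl pr v S A (v ∷ B) (c + length A) P Q)
  (trans (cong₂ (λ e g → consume (mkBlock e (pl v)) P λ P′ →
                          consume (mkBlock g (pr v)) Q (signedPairCount pl pr S (A , v ∷ B , c + length A) P′))
                (∉⇒memb v∉A) (memb-here v B))
         (consume-cong (pl v) P λ P′ → consume-cong (0 ∷ pr v) Q λ Q′ →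
           trans (cong (λ Y → sgnℚ (c + length A) *ℚ (⟦ eqK (blocksOf pl A S) P′ ⟧ *ℚ ⟦ eqK Y Q′ ⟧)) (blocksOf-∷-∉ pr B v∉S))
                 (sgnℚ-transfer c (length A) (blocksOf pl A S) P′ _ countFerm≡)))

consume²-sumℚ : ∀ {A : Set} b P b′ Q (l : List A) (h : A → SSC → SSC → ℚ) →
  sumℚ (map (λ t → consume b P (λ P′ → consume b′ Q (h t P′))) l)
  ≡ consume b P (λ P′ → consume b′ Q (λ Q′ → sumℚ (map (λ t → h t P′ Q′) l)))
consume²-sumℚ b P b′ Q l h = trans (consume-sumℚ b P l _) (consume-cong b P λ P′ → consume-sumℚ b′ Q l (λ t → h t P′))

splitSum≡splitCount : ∀ θ pl pr → (∀ v → Positive (pl v)) → ∀ S → Sorted S → ∀ P Q →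
                      splitSum θ pl pr S P Q ≡ splitCount (map (letterData θ pl pr) S) P Q
splitSum≡splitCount θ pl pr pl⁺ [] _ P Q =
  trans (cong₂ (λ a b → 1ℚ *ℚ (a *ℚ b) +ℚ 0ℚ) (⟦eqK[]⟧-sym P) (⟦eqK[]⟧-sym Q))
        (solve 2 (λ a b → con 1ℚ :* (a :* b) :+ con 0ℚ := a :* b) refl ⟦ eqK P [] ⟧ ⟦ eqK Q [] ⟧)
splitSum≡splitCount θ pl pr pl⁺ (v ∷ S) s P Q with θ v
... | false = begin
  sumℚ (map (λ t → signedPairCount pl pr (v ∷ S) t P Q) (splitsθ Tθ))
    ≡⟨ cong sumℚ (map-cong-∈ (splitsθ Tθ) λ {(A , B , c)} t∈ →
         signedPairCount-∷-absent pl pr c P Q (v∉Tθ ∘ ⊆ˡ (I t∈)) (v∉Tθ ∘ ⊆ʳ (I t∈))) ⟩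
  sumℚ (map (λ t → consume (pl v) P (λ P′ → consume (pr v) Q (signedPairCount pl pr S t P′))) (splitsθ Tθ))
    ≡⟨ consume²-sumℚ (pl v) P (pr v) Q (splitsθ Tθ) _ ⟩
  consume (pl v) P (λ P′ → consume (pr v) Q (splitSum θ pl pr S P′))
    ≡⟨ consume-cong (pl v) P (λ P′ → consume-cong (pr v) Q (IH P′)) ⟩
  splitCount ((false , pl v , pr v) ∷ D) P Q ∎
  where
  open ≡-Reasoning
  open Interleaving
  Tθ = filterᵇ θ S
  D = map (letterData θ pl pr) S
  I : ∀ {A B c} → (A , B , c) ∈ splitsθ Tθ → Interleaving Tθ A B
  I = splitsθ-interleaving (filterᵇ-sorted θ (Linked.tail s))
  v∉Tθ = sorted-head∉ s ∘ filter-⊆ (T? ∘ θ) S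
  IH = splitSum≡splitCount θ pl pr pl⁺ S (Linked.tail s)
... | true = begin
  sumℚ (map f (concatMap (λ t → left t ∷ right t ∷ []) (splitsθ Tθ)))
    ≡⟨ trans (cong sumℚ (map-concatMap f _ (splitsθ Tθ))) (sumℚ-concatMap _ (splitsθ Tθ)) ⟩
  sumℚ (map (λ t → f (left t) +ℚ (f (right t) +ℚ 0ℚ)) (splitsθ Tθ))
    ≡⟨ cong sumℚ (map-cong-∈ (splitsθ Tθ) λ {(A , B , c)} t∈ → cong₂ _+ℚ_
         (signedPairCount-∷-left pl pr A c P Q v∉S (v∉Tθ ∘ ⊆ʳ (I t∈)))
         (trans (ℚ.+-identityʳ _) (signedPairCount-∷-right pl pr B c P Q v∉S (v∉Tθ ∘ ⊆ˡ (I t∈))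
           (countFerm-blocksOf pl pl⁺ (Linked.tail s) (sortedˡ (I t∈)) (filter-⊆ (T? ∘ θ) S ∘ ⊆ˡ (I t∈)))))) ⟩
  sumℚ (map (λ t → Lterm t +ℚ Rterm t) (splitsθ Tθ))
    ≡⟨ sumℚ-map-+ Lterm Rterm (splitsθ Tθ) ⟩
  sumℚ (map Lterm (splitsθ Tθ)) +ℚ sumℚ (map Rterm (splitsθ Tθ))
    ≡⟨ cong₂ _+ℚ_ (consume²-sumℚ (0 ∷ pl v) P (pr v) Q (splitsθ Tθ) _) (consume²-sumℚ (pl v) P (0 ∷ pr v) Q (splitsθ Tθ) _) ⟩
  consume (0 ∷ pl v) P (λ P′ → consume (pr v) Q (splitSum θ pl pr S P′))
  +ℚ consume (pl v) P (λ P′ → consume (0 ∷ pr v) Q λ Q′ →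
       sumℚ (map (λ t → sgnℚ (countFerm P′) *ℚ signedPairCount pl pr S t P′ Q′) (splitsθ Tθ)))
    ≡⟨ cong₂ _+ℚ_ (consume-cong (0 ∷ pl v) P λ P′ → consume-cong (pr v) Q (IH P′))
                  (consume-cong (pl v) P λ P′ → consume-cong (0 ∷ pr v) Q λ Q′ →
                    trans (sumℚ-map-*ˡ (sgnℚ (countFerm P′)) (λ t → signedPairCount pl pr S t P′ Q′) (splitsθ Tθ))
                          (cong (sgnℚ (countFerm P′) *ℚ_) (IH P′ Q′))) ⟩
  splitCount ((true , pl v , pr v) ∷ D) P Q ∎
  where
  open ≡-Reasoning
  open Interleaving
  Tθ = filterᵇ θ S
  D = map (letterData θ pl pr) S
  I : ∀ {A B c} → (A , B , c) ∈ splitsθ Tθ → Interleaving Tθ A B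
  I = splitsθ-interleaving (filterᵇ-sorted θ (Linked.tail s))
  v∉S = sorted-head∉ s
  v∉Tθ = v∉S ∘ filter-⊆ (T? ∘ θ) S
  IH = splitSum≡splitCount θ pl pr pl⁺ S (Linked.tail s)
  f = λ t → signedPairCount pl pr (v ∷ S) t P Q
  left right : θSplit → θSplit
  left  (A , B , c) = v ∷ A , B , c
  right (A , B , c) = A , v ∷ B , c + length A
  Lterm Rterm : θSplit → ℚ
  Lterm t = consume (0 ∷ pl v) P (λ P′ → consume (pr v) Q (signedPairCount pl pr S t P′))
  Rterm t = consume (pl v) P (λ P′ → consume (0 ∷ pr v) Q (λ Q′ → sgnℚ (countFerm P′) *ℚ signedPairCount pl pr S t P′ Q′))

shiftPos : ℕ → ℕ → ℕ
shiftPos n x = if isZero x then 0 else x + n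

shiftPos-injective : ∀ n {a b} → shiftPos n a ≡ shiftPos n b → a ≡ b
shiftPos-injective n {zero}  {zero}  _ = refl
shiftPos-injective n {suc a} {suc b} e = cong suc (+-cancelʳ-≡ n a b (suc-injective e))

eqK-shift : ∀ n K J → eqK K J ≡ eqK (shift n K) (shift n J)
eqK-shift n K J with eqK K J | eqK-reflects K J
... | true  | ofʸ refl = sym (dec-true (shift n K ≟SSC shift n K) refl)
... | false | ofⁿ K≢J  = sym (dec-false (shift n K ≟SSC shift n J) (K≢J ∘ map-injective (map-injective (shiftPos-injective n))))

map-shiftPos-mkBlock : ∀ n f ps → map (shiftPos n) (mkBlock f ps) ≡ mkBlock f (map (shiftPos n) ps)
map-shiftPos-mkBlock n true  ps = refl
map-shiftPos-mkBlock n false ps = refl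

map-shiftPos-positionsFrom : ∀ n t v X → map (shiftPos n) (positionsFrom (suc t) v X) ≡ positionsFrom (suc t + n) v X
map-shiftPos-positionsFrom n t v []      = refl
map-shiftPos-positionsFrom n t v (x ∷ X) with v ≡ᵇ x
... | true  = cong (suc t + n ∷_) (map-shiftPos-positionsFrom n (suc t) v X)
... | false = map-shiftPos-positionsFrom n (suc t) v X

shift-blocksOf : ∀ n b B S → shift n (blocksOf (λ v → positionsFrom 1 v b) B S) ≡ blocksOf (λ v → positionsFrom (suc n) v b) B S
shift-blocksOf n b B S = begin
  map (map (shiftPos n)) (filterᵇ nonEmpty L)                               ≡⟨ cong (map (map (shiftPos n))) (filterᵇ-cong nonEmpty-map L) ⟩
  map (map (shiftPos n)) (filterᵇ (λ c → nonEmpty (map (shiftPos n) c)) L) ≡⟨ map-filterᵇ (map (shiftPos n)) nonEmpty L ⟩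
  filterᵇ nonEmpty (map (map (shiftPos n)) L)
    ≡⟨ cong (filterᵇ nonEmpty) (trans (sym (map-∘ S)) (map-cong shift-letter S)) ⟩
  blocksOf (λ v → positionsFrom (suc n) v b) B S                            ∎
  where
  open ≡-Reasoning
  L = map (λ v → mkBlock (memb v B) (positionsFrom 1 v b)) S
  nonEmpty-map : ∀ c → nonEmpty c ≡ nonEmpty (map (shiftPos n) c)
  nonEmpty-map []      = refl
  nonEmpty-map (_ ∷ _) = refl
  shift-letter : ∀ v → map (shiftPos n) (mkBlock (memb v B) (positionsFrom 1 v b)) ≡ mkBlock (memb v B) (positionsFrom (suc n) v b)
  shift-letter v = trans (map-shiftPos-mkBlock n (memb v B) _) (cong (mkBlock (memb v B)) (map-shiftPos-positionsFrom n 0 v b))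

data MkBlockView : Block → Set where
  mkBlockView : ∀ f {ps} → Positive ps → MkBlockView (mkBlock f ps)

sorted⇒mkBlockView : ∀ {x} → Sorted x → MkBlockView x
sorted⇒mkBlockView {[]}        _ = mkBlockView false []
sorted⇒mkBlockView {zero ∷ _}  s = mkBlockView true (tabulate (sorted-head s))
sorted⇒mkBlockView {suc _ ∷ _} s = mkBlockView false (s≤s z≤n ∷ tabulate (≤-<-trans z≤n ∘ sorted-head s))

IsSSC⇒lowBlocks : ∀ {I} → IsSSC I → All (LowBlock (bidegN I)) I
IsSSC⇒lowBlocks {I} (I≢[] , sortedI , perm) = lowBlocks I I≢[] sortedI (λ z∈ → bound (∈-resp-↭ perm z∈))
  where
  n = bidegN I
  bound : ∀ {z} → z ∈ applyUpTo suc n → z ≤ n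
  bound z∈ with ∈-applyUpTo⁻ suc z∈
  ... | _ , i<n , refl = i<n
  lowBlocks : ∀ I′ → All (_≢ []) I′ → All Sorted I′ → (∀ {z} → z ∈ concatMap positives I′ → z ≤ n) → All (LowBlock n) I′
  lowBlocks []       _            _          _     = []
  lowBlocks (x ∷ I′) (x≢[] ∷ ne) (sx ∷ ss) bound′ with sorted⇒mkBlockView sx
  ... | mkBlockView f {ps} pos =
    lowBlock f (tabulate λ {p} p∈ → All.lookup pos p∈ , bound′ (∈-++⁺ˡ (subst (p ∈_) (sym (positives-mkBlock f pos)) p∈))) x≢[]
    ∷ lowBlocks I′ ne ss (bound′ ∘ ∈-++⁺ʳ (positives (mkBlock f ps)))

IsSSC⇒highBlocks : ∀ n {J} → IsSSC J → All (HighBlock n) (shift n J)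
IsSSC⇒highBlocks n {J} (J≢[] , sortedJ , _) = highBlocks J J≢[] sortedJ
  where
  map-≢[] : ∀ {y} → y ≢ [] → map (shiftPos n) y ≢ []
  map-≢[] {[]}    y≢[] = ⊥-elim (y≢[] refl)
  map-≢[] {_ ∷ _} _    = λ ()
  high : ∀ {ps} → Positive ps → HighPositions n (map (shiftPos n) ps)
  high []                   = []
  high {suc p ∷ _} (_ ∷ pos) = s≤s (m≤n+m n p) ∷ high pos
  highBlocks : ∀ J′ → All (_≢ []) J′ → All Sorted J′ → All (HighBlock n) (shift n J′)
  highBlocks []       _            _          = []
  highBlocks (y ∷ J′) (y≢[] ∷ ne) (sy ∷ ss) with sorted⇒mkBlockView sy
  ... | mkBlockView f {ps} pos =
    subst (HighBlock n) (sym (map-shiftPos-mkBlock n f ps))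
          (highBlock f (high pos) (subst (_≢ []) (map-shiftPos-mkBlock n f ps) (map-≢[] y≢[])))
    ∷ highBlocks J′ ne ss

M-vanish : ∀ I A a → length a ≢ bidegN I → M I (mkMono A a) ≡ 0ℚ
M-vanish I A a |a|≢n with eqK (sscOf (mkMono A a)) I | eqK-reflects (sscOf (mkMono A a)) I
... | true  | ofʸ K≡I = ⊥-elim (|a|≢n (trans (sym (bidegN-sscOf (mkMono A a))) (cong bidegN K≡I)))
... | false | _       = refl

thetaIdx≡filterᵇ : ∀ w → thetaIdx w ≡ filterᵇ (λ v → memb v (thetaIdx w)) (ind w)
thetaIdx≡filterᵇ w = sorted-⊆-antisym (thetaIdx-sorted w) (filterᵇ-sorted θ (toSortedSet-sorted (Θ ++ xWord w)))
  (λ {v} v∈ → ∈-filter⁺ (T? ∘ θ) (⊆-toSortedSet (Θ ++ xWord w) (∈-++⁺ˡ v∈)) (reflects-⇒T (memb-reflects v Θ) v∈))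
  (λ {v} v∈ → reflects-T⇒ (memb-reflects v Θ) (proj₂ (∈-filter⁻ (T? ∘ θ) {xs = ind w} v∈)))
  where
  Θ = thetaIdx w
  θ = λ v → memb v Θ

letterData-valid : ∀ n Θ X {v} → v ∈ letters Θ X →
  ValidLetter n (letterData (λ v → memb v Θ) (λ v → positionsFrom 1 v (take n X)) (λ v → positionsFrom (suc n) v (drop n X)) v)
letterData-valid n Θ X {v} v∈ =
  All.map (λ (1≤p , p<) → 1≤p , ≤-trans (≤-pred p<) (≤-trans (≤-reflexive (length-take n X)) (m⊓n≤m n (length X))))
          (positionsFrom-bounds 1 v (take n X)) ,
  All.map proj₁ (positionsFrom-bounds (suc n) v (drop n X)) ,
  λ block≡[] → subst (T ∘ nonEmpty) (trans (cong (mkBlock (memb v Θ)) (positionsFrom-take-drop 1 v n X)) block≡[])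
                     (reflects-⇒T (nonEmpty-letterBlock Θ X v) (∈-++⁻ Θ (toSortedSet-⊆ (Θ ++ X) v∈)))

M·M≡qshSum : ∀ I J → IsSSC I → IsSSC J → ∀ w → (M I · M J) w ≡ qshSum I J w
M·M≡qshSum I J ssc-I ssc-J w = begin
  (M I · M J) w
    ≡⟨ sumℚ-concatMap _ (splitsθ Θ) ⟩
  sumℚ (map (λ t → sumℚ (map (productTerm (M I) (M J) t) (splitsX X))) (splitsθ Θ))
    ≡⟨ cong sumℚ (map-cong (λ t → splitsX-pick n X (productTerm (M I) (M J) t) (vanish t)) (splitsθ Θ)) ⟩
  sumℚ (map (λ t → productTerm (M I) (M J) t (a , b)) (splitsθ Θ))
    ≡⟨ cong sumℚ (map-cong-∈ (splitsθ Θ) term≡) ⟩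
  sumℚ (map (λ t → signedPairCount pl pr S t I Q) (splitsθ Θ))
    ≡⟨ cong (λ Θ′ → sumℚ (map (λ t → signedPairCount pl pr S t I Q) (splitsθ Θ′))) (thetaIdx≡filterᵇ w) ⟩
  splitSum θ pl pr S I Q
    ≡⟨ splitSum≡splitCount θ pl pr (λ v → positionsFrom-positive 0 v a) S (toSortedSet-sorted (Θ ++ X)) I Q ⟩
  splitCount D I Q
    ≡⟨ splitCount-qshCount D (All-map⁺ (tabulate (letterData-valid n Θ X))) (IsSSC⇒lowBlocks ssc-I) (IsSSC⇒highBlocks n ssc-J) ⟩
  qshCount I Q (map letterBlockOf D)
    ≡⟨ cong (qshCount I Q) (trans (sym (map-∘ S)) (map-cong (λ v → cong (mkBlock (θ v)) (sym (positionsFrom-take-drop 1 v n X))) S)) ⟩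
  qshCount I Q (map (letterBlock Θ X) S)
    ≡⟨ cong (qshCount I Q) (sscOf-letterwise w) ⟨
  qshCount I Q (sscOf w)
    ≡⟨ qshSum≡qshCount I J w ⟨
  qshSum I J w ∎
  where
  open ≡-Reasoning
  Θ = thetaIdx w
  X = xWord w
  S = letters Θ X
  n = bidegN I
  a = take n X
  b = drop n X
  θ = λ v → memb v Θ
  pl = λ v → positionsFrom 1 v a
  pr = λ v → positionsFrom (suc n) v b
  Q = shift n J
  D = map (letterData θ pl pr) S
  vanish : ∀ t a′ b′ → length a′ ≢ n → productTerm (M I) (M J) t (a′ , b′) ≡ 0ℚ
  vanish (A , B , c) a′ b′ |a′|≢n = productTerm-zeroˡ (M I) (M J) {A} {B} {c} {a′} {b′} (M-vanish I A a′ |a′|≢n)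
  ⊆S : ∀ {Y} → Y ⊆ X → Y ⊆ S
  ⊆S Y⊆X = ⊆-toSortedSet (Θ ++ X) ∘ ∈-++⁺ʳ Θ ∘ Y⊆X
  term≡ : ∀ {t} → t ∈ splitsθ Θ → productTerm (M I) (M J) t (a , b) ≡ signedPairCount pl pr S t I Q
  term≡ {A , B , c} t∈ = cong₂ (λ x y → sgnℚ c *ℚ (⟦ x ⟧ *ℚ ⟦ y ⟧))
    (cong (λ K → eqK K I) (sscOf-mkMono a sortedˡ sS (Θ⊆S ∘ ⊆ˡ) (⊆S (subst (a ⊆_) (take++drop≡id n X) (xs⊆xs++ys a b)))))
    (trans (cong (λ K → eqK K J) (sscOf-mkMono b sortedʳ sS (Θ⊆S ∘ ⊆ʳ) (⊆S (subst (b ⊆_) (take++drop≡id n X) (xs⊆ys++xs b a)))))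
    (trans (eqK-shift n (blocksOf (λ v → positionsFrom 1 v b) B S) J) (cong (λ K → eqK K Q) (shift-blocksOf n b B S))))
    where
    open Interleaving (splitsθ-interleaving (thetaIdx-sorted w) t∈)
    sS = toSortedSet-sorted (Θ ++ X)
    Θ⊆S : Θ ⊆ S
    Θ⊆S = ⊆-toSortedSet (Θ ++ X) ∘ ∈-++⁺ˡ

proposition4p1 : ((I J : SSC) → IsSSC I → IsSSC J → ∀ w → (M I · M J) w ≡ qshSum I J w)
    × (InSNCQSym oneS
       × (∀ f g → InSNCQSym f → InSNCQSym g → InSNCQSym (f ⊕ g))
       × (∀ (q : ℚ) f → InSNCQSym f → InSNCQSym (q ⊙ f))
       × (∀ f g → InSNCQSym f → InSNCQSym g → InSNCQSym (f · g)))
proposition4p1 = M·M≡qshSum , oneS-sNCQSym , ⊕-sNCQSym , ⊙-sNCQSym , ·-sNCQSym
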